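{- Let ${\bf d}=(d_1,\ldots,d_n)$ with all $d_i\ge1$, ${\mathcal G}({\bf d})$ the uniformly random simple graph on $[n]$ with degree sequence ${\bf d}$, $n_2=|\{i:d_i=2\}|$, $M_1=\sum_id_i$, $\Delta=\max_id_i$, $d=M_1/n$. Suppose $\frac{\Delta^2}{d}=o\big(n^{1/3}/n_2^{1/3}\big)$. Then asymptotically almost surely ${\mathcal G}({\bf d})$ has no cycle containing two or fewer vertices of degree at least $3$.
   Context: Degree sequences are graphical with even sum; asymptotics as $n\to\infty$; "asymptotically almost surely" means with probability tending to $1$. -}

module Defs where

open import Data.Bool using (Bool; true; false; T; _∧_; not; if_then_else_)
open import Data.Nat using (ℕ; zero; suc; _+_; _*_; _^_; _≤_; _<_; _⊔_; _≡ᵇ_; _≤ᵇ_)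
open import Data.Fin using (Fin)
open import Data.Vec using (Vec; []; _∷_; lookup; countᵇ; foldr)
open import Data.List using (List; []; _∷_; _++_; length; map; concatMap; filterᵇ; all; allFin)
open import Data.List.Relation.Unary.Unique.Propositional using (Unique)
open import Data.Unit using (⊤)
open import Data.Product using (Σ; _×_; ∃)

_==_ : Bool → Bool → Bool
true == b = b
false == b = not b

Adj : ℕ → Set
Adj n = Vec (Vec Bool n) n

adj : ∀ {n} → Adj n → Fin n → Fin n → Bool
adj A i j = lookup (lookup A i) j

deg : ∀ {n} → Adj n → Fin n → ℕ
deg A i = countᵇ (λ b → b) (lookup A i)

isRealization : ∀ {n} → Vec ℕ n → Adj n → Bool
isRealization {n} d A =
  all (λ i → not (adj A i i) ∧ (deg A i ≡ᵇ lookup d i)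
             ∧ all (λ j → adj A i j == adj A j i) (allFin n))
      (allFin n)

allVecs : ∀ {A : Set} → List A → (m : ℕ) → List (Vec A m)
allVecs xs zero = [] ∷ []
allVecs xs (suc m) = concatMap (λ x → map (x ∷_) (allVecs xs m)) xs

allAdj : (n : ℕ) → List (Adj n)
allAdj n = allVecs (allVecs (true ∷ false ∷ []) n) n

numRealizations : ∀ {n} → Vec ℕ n → ℕ
numRealizations {n} d = length (filterᵇ (isRealization d) (allAdj n))

Graphical : ∀ {n} → Vec ℕ n → Set
Graphical {n} d = ∃ λ (A : Adj n) → T (isRealization d A)

Walk : ∀ {n} → Adj n → List (Fin n) → Set
Walk A [] = ⊤
Walk A (x ∷ []) = ⊤
Walk A (x ∷ y ∷ r) = T (adj A x y) × Walk A (y ∷ r)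

IsCycle : ∀ {n} → Adj n → Fin n → List (Fin n) → Set
IsCycle A v rest = 2 ≤ length rest × Unique (v ∷ rest) × Walk A (v ∷ rest ++ v ∷ [])

highDegCount : ∀ {n} → Vec ℕ n → List (Fin n) → ℕ
highDegCount d vs = length (filterᵇ (λ u → 3 ≤ᵇ lookup d u) vs)

HasShortCycle : ∀ {n} → Vec ℕ n → Adj n → Set
HasShortCycle d A =
  Σ _ λ v → Σ _ λ rest → IsCycle A v rest × highDegCount d (v ∷ rest) ≤ 2

M₁ : ∀ {n} → Vec ℕ n → ℕ
M₁ d = foldr _ _+_ 0 d

Δ : ∀ {n} → Vec ℕ n → ℕ
Δ d = foldr _ _⊔_ 0 d

n₂ : ∀ {n} → Vec ℕ n → ℕ
n₂ d = countᵇ (λ x → x ≡ᵇ 2) d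

-- Call a realization with a marked cycle bad if the cycle has at most two vertices of degree ≥ 3; a bad
-- cycle of length k then has at least max(1, k − 2) vertices of degree 2. Switch such a vertex w, with cycle
-- neighbours a and b, off the cycle using an ordered edge xy away from it: if ab is an edge, replace wa, xy
-- by wx, ay; otherwise replace wa, wb, xy by ab, wx, wy, which moves w onto the edge xy. Degrees are kept,
-- and the marked cycle loses w (a triangle is destroyed instead); all but O((n₂ + Δ) Δ) of the M₁ ordered
-- edges can be used. Conversely, the bad graph and the switching are recovered from the result in O(k n₂ Δ)
-- ways, or in O(n₂ Δ²) ways from an unmarked realization when a triangle was destroyed. Double counting
-- gives |bad| M₁ ≤ 648 n₂ Δ² |G(d)| once 94 n₂ Δ² ≤ M₁, and the hypothesis Δ⁶ n² n₂ = o(M₁³), with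
-- n₂ ≤ n, makes n₂ Δ² = o(M₁).

module Submission where

open import Defs
open import Data.Bool using (Bool; true; false; T; not; _∧_; _∨_; if_then_else_)
open import Data.Bool.ListAction using (all)
open import Data.Bool.Properties using (T-∧; T-≡; T-not-≡)
open import Data.Empty using (⊥-elim)
open import Data.Fin using (Fin; zero; suc)
open import Data.Fin.Properties using (_≟_; suc-injective)
open import Data.List
  using ( List; []; _∷_; _++_; length; map; concatMap; filter; filterᵇ; allFin; tabulate; upTo; applyUpTo
        ; drop; take; cartesianProduct)
import Data.List.Properties as List
open import Data.List.Membership.Propositional using (_∈_; _∉_; find; lose)
open import Data.List.Membership.Propositional.Properties
open import Data.List.Relation.Unary.All as All using (All; []; _∷_)
import Data.List.Relation.Unary.All.Properties as AllP
open import Data.List.Relation.Unary.AllPairs as AllPairs using (AllPairs; []; _∷_)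
import Data.List.Relation.Unary.AllPairs.Properties as AllPairsP
open import Data.List.Relation.Unary.Any as Any using (here; there)
open import Data.List.Relation.Unary.Unique.Propositional using (Unique)
import Data.List.Relation.Unary.Unique.Propositional.Properties as UniqueP
open import Data.Nat
  using (ℕ; zero; suc; _+_; _*_; _^_; _∸_; _≤_; _<_; z≤n; s≤s; _≤?_; _≡ᵇ_; _≤ᵇ_; NonZero; >-nonZero)
open import Data.Nat.ListAction using (sum)
open import Data.Nat.Properties hiding (_≟_; suc-injective)
open import Data.Nat.Solver using (module +-*-Solver)
open import Data.Product using (_×_; _,_; proj₁; proj₂; ∃; swap)
open import Data.Product.Properties using (,-injectiveʳ)
open import Data.Sum using (_⊎_; inj₁; inj₂)
open import Data.Unit using (⊤; tt)
open import Data.Vec using (Vec; lookup; countᵇ)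
import Data.Vec as Vec
import Data.Vec.Properties as Vec
import Data.Vec.Relation.Unary.All as V
open import Function using (_∘_; id; Equivalence)
open import Relation.Binary.PropositionalEquality
  using (_≡_; _≢_; refl; sym; trans; cong; cong₂; subst; subst₂; ≢-sym; module ≡-Reasoning)
open import Relation.Nullary using (¬_; Dec; yes; no; does)
open import Relation.Nullary.Decidable using (T?; isYes; toWitness; toWitnessFalse; dec-true; dec-false; _×-dec_; _⊎-dec_)
import Data.List.Relation.Unary.Unique.DecPropositional as UniqueDec

module _ {a} {A : Set a} where

  ∈-++-skip : ∀ {z x : A} ys₁ {ys₂} → z ≢ x → z ∈ ys₁ ++ x ∷ ys₂ → z ∈ ys₁ ++ ys₂
  ∈-++-skip []        z≢x (here z≡x) = ⊥-elim (z≢x z≡x)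
  ∈-++-skip []        z≢x (there z∈) = z∈
  ∈-++-skip (y ∷ ys₁) z≢x (here z≡y) = here z≡y
  ∈-++-skip (y ∷ ys₁) z≢x (there z∈) = there (∈-++-skip ys₁ z≢x z∈)

  unique-⊆⇒length-≤ : ∀ {xs ys : List A} → Unique xs → (∀ {z} → z ∈ xs → z ∈ ys) → length xs ≤ length ys
  unique-⊆⇒length-≤ {[]}     _           _     = z≤n
  unique-⊆⇒length-≤ {x ∷ xs} (x∉xs ∷ xs!) xs⊆ys with ys₁ , ys₂ , refl ← ∈-∃++ (xs⊆ys (here refl)) = begin
    suc (length xs)                ≤⟨ s≤s (unique-⊆⇒length-≤ xs! xs⊆ys₁ys₂) ⟩
    suc (length (ys₁ ++ ys₂))      ≡⟨ cong suc (List.length-++ ys₁) ⟩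
    suc (length ys₁ + length ys₂)  ≡⟨ +-suc (length ys₁) (length ys₂) ⟨
    length ys₁ + length (x ∷ ys₂)  ≡⟨ List.length-++ ys₁ ⟨
    length (ys₁ ++ x ∷ ys₂)        ∎
    where
    open ≤-Reasoning
    xs⊆ys₁ys₂ : ∀ {z} → z ∈ xs → z ∈ ys₁ ++ ys₂
    xs⊆ys₁ys₂ z∈xs = ∈-++-skip ys₁ (λ z≡x → All.lookup x∉xs z∈xs (sym z≡x)) (xs⊆ys (there z∈xs))

  ∈-concatMap⁺′ : ∀ {b} {B : Set b} (f : B → List A) {xs x z} → x ∈ xs → z ∈ f x → z ∈ concatMap f xs
  ∈-concatMap⁺′ f {xs} x∈xs z∈fx = ∈-concatMap⁺ f {xs = xs} (lose x∈xs z∈fx)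

  ∈-concatMap⁻′ : ∀ {b} {B : Set b} (f : B → List A) xs {z} → z ∈ concatMap f xs → ∃ λ x → x ∈ xs × z ∈ f x
  ∈-concatMap⁻′ f xs z∈ = find (∈-concatMap⁻ f {xs = xs} z∈)

  unique-concatMap : ∀ {b} {B : Set b} (f : B → List A) (tag : A → B) {xs : List B} →
    Unique xs → (∀ x → Unique (f x)) → (∀ {x z} → z ∈ f x → tag z ≡ x) → Unique (concatMap f xs)
  unique-concatMap f tag {[]}     _            _   _       = []
  unique-concatMap f tag {x ∷ xs} (x∉xs ∷ xs!) f! tagged =
    UniqueP.++⁺ (f! x) (unique-concatMap f tag xs! f! tagged) disjoint
    where
    disjoint : ∀ {z} → ¬ (z ∈ f x × z ∈ concatMap f xs)
    disjoint (z∈fx , z∈) with x′ , x′∈xs , z∈fx′ ← ∈-concatMap⁻′ f xs z∈ =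
      All.lookup x∉xs x′∈xs (trans (sym (tagged z∈fx)) (tagged z∈fx′))

  length-concatMap : ∀ {b} {B : Set b} (f : B → List A) xs → length (concatMap f xs) ≡ sum (map (length ∘ f) xs)
  length-concatMap f []       = refl
  length-concatMap f (x ∷ xs) = trans (List.length-++ (f x)) (cong (length (f x) +_) (length-concatMap f xs))

  length-filterᵇ-∘ : ∀ {b} {B : Set b} (p : B → Bool) (h : A → B) xs →
    length (filterᵇ (p ∘ h) xs) ≡ length (filterᵇ p (map h xs))
  length-filterᵇ-∘ p h []       = refl
  length-filterᵇ-∘ p h (x ∷ xs) with p (h x)
  ... | true  = cong suc (length-filterᵇ-∘ p h xs)
  ... | false = length-filterᵇ-∘ p h xs

  length-filterᵇ-++ : ∀ (p : A → Bool) xs ys →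
    length (filterᵇ p (xs ++ ys)) ≡ length (filterᵇ p xs) + length (filterᵇ p ys)
  length-filterᵇ-++ p []       ys = refl
  length-filterᵇ-++ p (x ∷ xs) ys with p x
  ... | true  = cong suc (length-filterᵇ-++ p xs ys)
  ... | false = length-filterᵇ-++ p xs ys

  length-filterᵇ-∷ : ∀ (p : A → Bool) x xs → length (filterᵇ p xs) ≤ length (filterᵇ p (x ∷ xs))
  length-filterᵇ-∷ p x xs with p x
  ... | true  = n≤1+n _
  ... | false = ≤-refl

  length≤length-filterᵇ-+ : ∀ (p q : A → Bool) xs → (∀ {x} → x ∈ xs → T (p x) ⊎ T (q x)) →
    length xs ≤ length (filterᵇ p xs) + length (filterᵇ q xs)
  length≤length-filterᵇ-+ p q []       _     = z≤n
  length≤length-filterᵇ-+ p q (x ∷ xs) cover with p x | q x | cover (here refl)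
    | length≤length-filterᵇ-+ p q xs (cover ∘ there)
  ... | true  | true  | _       | ih = s≤s (≤-trans ih (+-monoʳ-≤ _ (n≤1+n _)))
  ... | true  | false | _       | ih = s≤s ih
  ... | false | true  | _       | ih = ≤-trans (s≤s ih) (≤-reflexive (sym (+-suc _ _)))
  ... | false | false | inj₁ () | _
  ... | false | false | inj₂ () | _

  length-filterᵇ-∨ : ∀ (p q : A → Bool) xs →
    length (filterᵇ (λ x → p x ∨ q x) xs) ≤ length (filterᵇ p xs) + length (filterᵇ q xs)
  length-filterᵇ-∨ p q []       = z≤n
  length-filterᵇ-∨ p q (x ∷ xs) with p x | q x | length-filterᵇ-∨ p q xs
  ... | true  | true  | ih = s≤s (≤-trans ih (+-monoʳ-≤ _ (n≤1+n _)))
  ... | true  | false | ih = s≤s ih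
  ... | false | true  | ih = ≤-trans (s≤s ih) (≤-reflexive (sym (+-suc _ _)))
  ... | false | false | ih = ih

  sum-map-≤-* : ∀ (g : A → ℕ) xs {B} → (∀ {x} → x ∈ xs → g x ≤ B) → sum (map g xs) ≤ length xs * B
  sum-map-≤-* g []       _ = z≤n
  sum-map-≤-* g (x ∷ xs) g≤B = +-mono-≤ (g≤B (here refl)) (sum-map-≤-* g xs (g≤B ∘ there))

  sum-map-mono-≤ : ∀ (g h : A → ℕ) xs → (∀ {x} → x ∈ xs → g x ≤ h x) → sum (map g xs) ≤ sum (map h xs)
  sum-map-mono-≤ g h []       _   = z≤n
  sum-map-mono-≤ g h (x ∷ xs) g≤h = +-mono-≤ (g≤h (here refl)) (sum-map-mono-≤ g h xs (g≤h ∘ there))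

  sum-map-≤-+ : ∀ (f g h : A → ℕ) xs → (∀ {x} → x ∈ xs → f x ≤ g x + h x) →
    sum (map f xs) ≤ sum (map g xs) + sum (map h xs)
  sum-map-≤-+ f g h []       _ = z≤n
  sum-map-≤-+ f g h (x ∷ xs) f≤g+h = begin
    f x + sum (map f xs)                             ≤⟨ +-mono-≤ (f≤g+h (here refl)) (sum-map-≤-+ f g h xs (f≤g+h ∘ there)) ⟩
    (g x + h x) + (sum (map g xs) + sum (map h xs))  ≡⟨ +-*-Solver.solve 4 (λ a b c d → (a :+ b) :+ (c :+ d) := (a :+ c) :+ (b :+ d))
                                                          refl (g x) (h x) _ _ ⟩
    (g x + sum (map g xs)) + (h x + sum (map h xs))  ∎
    where open ≤-Reasoning; open +-*-Solver using (_:+_; _:=_)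

  length≤sum-map : ∀ (g : A → ℕ) xs → (∀ {x} → x ∈ xs → 1 ≤ g x) → length xs ≤ sum (map g xs)
  length≤sum-map g []       _    = z≤n
  length≤sum-map g (x ∷ xs) 1≤g = +-mono-≤ (1≤g (here refl)) (length≤sum-map g xs (1≤g ∘ there))

  sum-map-const : ∀ c xs → sum (map (λ (_ : A) → c) xs) ≡ length xs * c
  sum-map-const c []       = refl
  sum-map-const c (x ∷ xs) = cong (c +_) (sum-map-const c xs)

  sum-map-* : ∀ (g : A → ℕ) c xs → sum (map (λ x → g x * c) xs) ≡ sum (map g xs) * c
  sum-map-* g c []       = refl
  sum-map-* g c (x ∷ xs) = trans (cong (g x * c +_) (sum-map-* g c xs)) (sym (*-distribʳ-+ c (g x) _))

proj₁-∈-map : ∀ {a b} {A : Set a} {B : Set b} {x : A} {z : A × B} {ys} → z ∈ map (x ,_) ys → proj₁ z ≡ x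
proj₁-∈-map z∈ with _ , _ , refl ← ∈-map⁻ _ z∈ = refl

∃-∈ : ∀ {a} {A : Set a} {xs : List A} → 1 ≤ length xs → ∃ (_∈ xs)
∃-∈ {xs = x ∷ _} _ = x , here refl

length-concatMap-≤ : ∀ {a b} {A : Set a} {B : Set b} (f : B → List A) xs {K} →
  (∀ {x} → x ∈ xs → length (f x) ≤ K) → length (concatMap f xs) ≤ length xs * K
length-concatMap-≤ f xs ≤K = subst (_≤ _) (sym (length-concatMap f xs)) (sum-map-≤-* (length ∘ f) xs ≤K)

module _ {a} {A : Set a} where

  headOr : A → List A → A
  headOr x []      = x
  headOr _ (y ∷ _) = y

  lastOr : A → List A → A
  lastOr x []       = x
  lastOr _ (y ∷ ys) = lastOr y ys

  lastOr-∈ : ∀ x ys → lastOr x ys ∈ x ∷ ys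
  lastOr-∈ x []       = here refl
  lastOr-∈ x (y ∷ ys) = there (lastOr-∈ y ys)

  rotate₁ : List A → List A
  rotate₁ []       = []
  rotate₁ (x ∷ xs) = xs ++ x ∷ []

  rotate : ℕ → List A → List A
  rotate zero    xs = xs
  rotate (suc i) xs = rotate i (rotate₁ xs)

  length-rotate : ∀ i xs → length (rotate i xs) ≡ length xs
  length-rotate zero    xs       = refl
  length-rotate (suc i) []       = length-rotate i []
  length-rotate (suc i) (x ∷ xs) =
    trans (length-rotate i (xs ++ x ∷ [])) (trans (List.length-++ xs) (+-comm (length xs) 1))

  unique-rotate : ∀ i xs → Unique xs → Unique (rotate i xs)
  unique-rotate zero    xs       xs!           = xs!
  unique-rotate (suc i) []       xs!           = unique-rotate i [] xs!
  unique-rotate (suc i) (x ∷ xs) (x∉xs ∷ xs!) = unique-rotate i _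
    (UniqueP.++⁺ xs! ([] ∷ []) λ { (z∈xs , here refl) → All.lookup x∉xs z∈xs refl })

  length-filterᵇ-rotate : ∀ (p : A → Bool) i xs → length (filterᵇ p (rotate i xs)) ≡ length (filterᵇ p xs)
  length-filterᵇ-rotate p zero    xs       = refl
  length-filterᵇ-rotate p (suc i) []       = length-filterᵇ-rotate p i []
  length-filterᵇ-rotate p (suc i) (x ∷ xs) = begin
    length (filterᵇ p (rotate i (xs ++ x ∷ [])))             ≡⟨ length-filterᵇ-rotate p i (xs ++ x ∷ []) ⟩
    length (filterᵇ p (xs ++ x ∷ []))                        ≡⟨ length-filterᵇ-++ p xs (x ∷ []) ⟩
    length (filterᵇ p xs) + length (filterᵇ p (x ∷ []))      ≡⟨ +-comm (length (filterᵇ p xs)) _ ⟩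
    length (filterᵇ p (x ∷ [])) + length (filterᵇ p xs)      ≡⟨ length-filterᵇ-++ p (x ∷ []) xs ⟨
    length (filterᵇ p (x ∷ xs))                              ∎
    where open ≡-Reasoning

  rotate-++ : ∀ xs ys → rotate (length xs) (xs ++ ys) ≡ ys ++ xs
  rotate-++ []       ys = sym (List.++-identityʳ ys)
  rotate-++ (x ∷ xs) ys = begin
    rotate (length xs) ((xs ++ ys) ++ x ∷ [])   ≡⟨ cong (rotate (length xs)) (List.++-assoc xs ys (x ∷ [])) ⟩
    rotate (length xs) (xs ++ ys ++ x ∷ [])     ≡⟨ rotate-++ xs (ys ++ x ∷ []) ⟩
    (ys ++ x ∷ []) ++ xs                        ≡⟨ List.++-assoc ys (x ∷ []) xs ⟩
    ys ++ x ∷ xs                                ∎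
    where open ≡-Reasoning

  rotate-+ : ∀ i j xs → rotate (i + j) xs ≡ rotate j (rotate i xs)
  rotate-+ zero    j xs = refl
  rotate-+ (suc i) j xs = rotate-+ i j (rotate₁ xs)

  rotate-length : ∀ xs → rotate (length xs) xs ≡ xs
  rotate-length xs = trans (cong (rotate (length xs)) (sym (List.++-identityʳ xs))) (rotate-++ xs [])

  rotate-back : ∀ i xs → i ≤ length xs → rotate (length (rotate i xs) ∸ i) (rotate i xs) ≡ xs
  rotate-back i xs i≤ = begin
    rotate (length (rotate i xs) ∸ i) (rotate i xs)  ≡⟨ cong (λ k → rotate (k ∸ i) (rotate i xs)) (length-rotate i xs) ⟩
    rotate (length xs ∸ i) (rotate i xs)             ≡⟨ rotate-+ i (length xs ∸ i) xs ⟨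
    rotate (i + (length xs ∸ i)) xs                  ≡⟨ cong (λ k → rotate k xs) (m+[n∸m]≡n i≤) ⟩
    rotate (length xs) xs                            ≡⟨ rotate-length xs ⟩
    xs                                               ∎
    where open ≡-Reasoning

  rotate-drop-take : ∀ i xs → i ≤ length xs → rotate i xs ≡ drop i xs ++ take i xs
  rotate-drop-take i xs i≤ = begin
    rotate i xs                                  ≡⟨ cong (λ k → rotate k xs) length-take ⟨
    rotate (length (take i xs)) xs               ≡⟨ cong (rotate (length (take i xs))) (List.take++drop≡id i xs) ⟨
    rotate (length (take i xs)) (take i xs ++ drop i xs) ≡⟨ rotate-++ (take i xs) (drop i xs) ⟩
    drop i xs ++ take i xs                       ∎
    where
    open ≡-Reasoning
    length-take : length (take i xs) ≡ i
    length-take = trans (List.length-take i xs) (m≤n⇒m⊓n≡m i≤)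

  headOr-drop-++ : ∀ x i xs ys → i < length xs → headOr x (drop i xs ++ ys) ≡ headOr x (drop i xs)
  headOr-drop-++ x zero    (_ ∷ _)  ys _         = refl
  headOr-drop-++ x (suc i) (_ ∷ xs) ys (s≤s i<) = headOr-drop-++ x i xs ys i<

  headOr-drop-upTo : ∀ x xs → map (λ i → headOr x (drop i xs)) (upTo (length xs)) ≡ xs
  headOr-drop-upTo x xs = trans (List.map-applyUpTo id _ (length xs)) (go xs)
    where
    go : ∀ ys → applyUpTo (λ i → headOr x (drop i ys)) (length ys) ≡ ys
    go []       = refl
    go (y ∷ ys) = cong (y ∷_) (go ys)

  headOr-rotate-upTo : ∀ x xs → map (λ i → headOr x (rotate i xs)) (upTo (length xs)) ≡ xs
  headOr-rotate-upTo x xs = trans (List.map-cong-local (All.tabulate (λ {i} i∈ → head≡ i (∈-upTo⁻ i∈))))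
                              (headOr-drop-upTo x xs)
    where
    head≡ : ∀ i → i < length xs → headOr x (rotate i xs) ≡ headOr x (drop i xs)
    head≡ i i< = trans (cong (headOr x) (rotate-drop-take i xs (<⇒≤ i<))) (headOr-drop-++ x i xs (take i xs) i<)

module _ {A : Set} where

  ∈-allVecs : (xs : List A) → (∀ z → z ∈ xs) → ∀ {m} (v : Vec A m) → v ∈ allVecs xs m
  ∈-allVecs xs all∈ Vec.[]       = here refl
  ∈-allVecs xs all∈ (x Vec.∷ v) =
    ∈-concatMap⁺′ (λ x → map (x Vec.∷_) (allVecs xs _)) (all∈ x) (∈-map⁺ (x Vec.∷_) (∈-allVecs xs all∈ v))

  unique-allVecs : ∀ {xs : List A} m → Unique xs → Unique (allVecs xs m)
  unique-allVecs zero    _   = [] ∷ []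
  unique-allVecs (suc m) xs! = unique-concatMap _ Vec.head xs!
    (λ x → UniqueP.map⁺ Vec.∷-injectiveʳ (unique-allVecs m xs!)) head≡
    where
    head≡ : ∀ {x z} → z ∈ map (x Vec.∷_) (allVecs _ m) → Vec.head z ≡ x
    head≡ z∈ with _ , _ , refl ← ∈-map⁻ _ z∈ = refl

  allLists : List A → ℕ → List (List A)
  allLists xs zero    = [] ∷ []
  allLists xs (suc m) = concatMap (λ x → map (x ∷_) (allLists xs m)) xs

  ∈-allLists : ∀ xs ys → All (_∈ xs) ys → ys ∈ allLists xs (length ys)
  ∈-allLists xs []       _             = here refl
  ∈-allLists xs (y ∷ ys) (y∈xs ∷ ys⊆xs) =
    ∈-concatMap⁺′ (λ x → map (x ∷_) (allLists xs (length ys))) y∈xs (∈-map⁺ (y ∷_) (∈-allLists xs ys ys⊆xs))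

  length-∈-allLists : ∀ xs m {ys} → ys ∈ allLists xs m → length ys ≡ m
  length-∈-allLists xs zero    (here refl) = refl
  length-∈-allLists xs (suc m) ys∈
    with _ , _ , zs∈  ← ∈-concatMap⁻′ (λ x → map (x ∷_) (allLists xs m)) xs ys∈
    with _ , zs∈′ , refl ← ∈-map⁻ _ zs∈ = cong suc (length-∈-allLists xs m zs∈′)

  unique-allLists : ∀ {xs : List A} m → Unique xs → Unique (allLists xs m)
  unique-allLists zero    _   = [] ∷ []
  unique-allLists {[]}     (suc m) _   = []
  unique-allLists {x₀ ∷ xs} (suc m) xs! = unique-concatMap _ (headOr x₀) xs!
    (λ x → UniqueP.map⁺ List.∷-injectiveʳ (unique-allLists m xs!)) head≡
    where
    head≡ : ∀ {x z} → z ∈ map (x ∷_) (allLists (x₀ ∷ xs) m) → headOr x₀ z ≡ x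
    head≡ z∈ with _ , _ , refl ← ∈-map⁻ _ z∈ = refl

∈-allAdj : ∀ {n} (A : Adj n) → A ∈ allAdj n
∈-allAdj A = ∈-allVecs _ (∈-allVecs _ λ { true → here refl ; false → there (here refl) }) A

unique-allAdj : ∀ n → Unique (allAdj n)
unique-allAdj n = unique-allVecs n (unique-allVecs n (((λ ()) ∷ []) ∷ [] ∷ []))

countᵇ≡length-filterᵇ : ∀ {a} {A : Set a} {n} (p : A → Bool) (v : Vec A n) →
  countᵇ p v ≡ length (filterᵇ (p ∘ lookup v) (allFin n))
countᵇ≡length-filterᵇ {n = n} p v = sym (begin
  length (filterᵇ (p ∘ lookup v) (allFin n))        ≡⟨ length-filterᵇ-∘ p (lookup v) (allFin n) ⟩
  length (filterᵇ p (map (lookup v) (allFin n)))    ≡⟨ cong (length ∘ filterᵇ p) (List.map-tabulate id (lookup v)) ⟩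
  length (filterᵇ p (tabulate (lookup v))) ≡⟨ tabulate-count (lookup v) ⟩
  countᵇ p (Vec.tabulate (lookup v))                ≡⟨ cong (countᵇ p) (Vec.tabulate∘lookup v) ⟩
  countᵇ p v                                        ∎)
  where
  open ≡-Reasoning
  tabulate-count : ∀ {m} (f : Fin m → _) → length (filterᵇ p (tabulate f)) ≡ countᵇ p (Vec.tabulate f)
  tabulate-count {zero}  f = refl
  tabulate-count {suc m} f with p (f zero)
  ... | true  = cong suc (tabulate-count (f ∘ suc))
  ... | false = tabulate-count (f ∘ suc)

lookup≤Δ : ∀ {n} (d : Vec ℕ n) i → lookup d i ≤ Δ d
lookup≤Δ (x Vec.∷ d) zero    = m≤m⊔n x _
lookup≤Δ (x Vec.∷ d) (suc i) = ≤-trans (lookup≤Δ d i) (m≤n⊔m x _)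

sum-lookup≡M₁ : ∀ {n} (d : Vec ℕ n) → sum (map (lookup d) (allFin n)) ≡ M₁ d
sum-lookup≡M₁ Vec.[]       = refl
sum-lookup≡M₁ (x Vec.∷ d) = cong (x +_) (trans (cong sum (List.map-tabulate suc (lookup (x Vec.∷ d))))
  (trans (cong sum (sym (List.map-tabulate id (lookup d)))) (sum-lookup≡M₁ d)))

degree2 : ∀ {n} → Vec ℕ n → List (Fin n)
degree2 {n} d = filterᵇ (λ i → lookup d i ≡ᵇ 2) (allFin n)

length-degree2 : ∀ {n} (d : Vec ℕ n) → length (degree2 d) ≡ n₂ d
length-degree2 d = sym (countᵇ≡length-filterᵇ (_≡ᵇ 2) d)

n₂≤n : ∀ {n} (d : Vec ℕ n) → n₂ d ≤ n
n₂≤n {n} d = subst₂ _≤_ (length-degree2 d) (List.length-tabulate id)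
  (List.length-filter (T? ∘ (λ i → lookup d i ≡ᵇ 2)) (allFin n))

∈-degree2⁺ : ∀ {n} (d : Vec ℕ n) {i} → lookup d i ≡ 2 → i ∈ degree2 d
∈-degree2⁺ d {i} d≡2 = ∈-filter⁺ (T? ∘ λ x → lookup d x ≡ᵇ 2) (∈-allFin i) (≡⇒≡ᵇ _ _ d≡2)

∈-degree2⁻ : ∀ {n} (d : Vec ℕ n) {i} → i ∈ degree2 d → lookup d i ≡ 2
∈-degree2⁻ {n} d i∈ = ≡ᵇ⇒≡ _ _ (proj₂ (∈-filter⁻ (T? ∘ λ x → lookup d x ≡ᵇ 2) {xs = allFin n} i∈))

neighbours : ∀ {n} → Adj n → Fin n → List (Fin n)
neighbours {n} A u = filterᵇ (adj A u) (allFin n)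

unique-neighbours : ∀ {n} (A : Adj n) u → Unique (neighbours A u)
unique-neighbours {n} A u = UniqueP.filter⁺ _ (UniqueP.allFin⁺ n)

∈-neighbours⁺ : ∀ {n} (A : Adj n) {u v} → adj A u v ≡ true → v ∈ neighbours A u
∈-neighbours⁺ A {u} {v} uv = ∈-filter⁺ (T? ∘ adj A u) (∈-allFin v) (Equivalence.from T-≡ uv)

∈-neighbours⁻ : ∀ {n} (A : Adj n) {u v} → v ∈ neighbours A u → adj A u v ≡ true
∈-neighbours⁻ {n} A {u} v∈ = Equivalence.to T-≡ (proj₂ (∈-filter⁻ (T? ∘ adj A u) {xs = allFin n} v∈))

Symmetric : ∀ {n} → Adj n → Set
Symmetric A = ∀ u v → adj A u v ≡ adj A v u

record Realization {n} (d : Vec ℕ n) (A : Adj n) : Set where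
  field
    loopless  : ∀ i → adj A i i ≡ false
    degree    : ∀ i → deg A i ≡ lookup d i
    symmetric : Symmetric A
open Realization public

T-== : ∀ {b c} → T (b == c) → b ≡ c
T-== {true}  {true}  _ = refl
T-== {false} {false} _ = refl

==-refl : ∀ b → T (b == b)
==-refl true  = tt
==-refl false = tt

realization⁻ : ∀ {n} {d : Vec ℕ n} {A : Adj n} → T (isRealization d A) → Realization d A
realization⁻ {n} {d} {A} r = record
  { loopless  = λ i → Equivalence.to T-not-≡ (proj₁ (row i))
  ; degree    = λ i → ≡ᵇ⇒≡ _ _ (proj₁ (Equivalence.to T-∧ (proj₂ (row i))))
  ; symmetric = λ i j →
      T-== (All.lookup (AllP.all⁺ _ (allFin n) (proj₂ (Equivalence.to T-∧ (proj₂ (row i))))) (∈-allFin j))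
  }
  where
  row : ∀ i → T (not (adj A i i)) × T ((deg A i ≡ᵇ lookup d i) ∧ all (λ j → adj A i j == adj A j i) (allFin n))
  row i = Equivalence.to T-∧ (All.lookup (AllP.all⁺ _ (allFin n) r) (∈-allFin i))

realization⁺ : ∀ {n} {d : Vec ℕ n} {A : Adj n} → Realization d A → T (isRealization d A)
realization⁺ {n} {d} {A} r = AllP.all⁻ row {allFin n} (All.tabulate λ {i} _ → Equivalence.from T-∧
  ( Equivalence.from T-not-≡ (loopless r i)
  , Equivalence.from T-∧ (≡⇒≡ᵇ _ _ (degree r i)
  , AllP.all⁻ (entry i) {allFin n} (All.tabulate λ {j} _ →
      subst (λ b → T (adj A i j == b)) (symmetric r i j) (==-refl (adj A i j))))))
  where
  entry : Fin n → Fin n → Bool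
  entry i j = adj A i j == adj A j i
  row : Fin n → Bool
  row i = not (adj A i i) ∧ (deg A i ≡ᵇ lookup d i) ∧ all (entry i) (allFin n)

module _ {n} {d : Vec ℕ n} {A : Adj n} (r : Realization d A) where

  length-neighbours : ∀ u → length (neighbours A u) ≡ lookup d u
  length-neighbours u = trans (sym (countᵇ≡length-filterᵇ id (lookup A u))) (degree r u)

  length-neighbours≤Δ : ∀ u → length (neighbours A u) ≤ Δ d
  length-neighbours≤Δ u = subst (_≤ Δ d) (sym (length-neighbours u)) (lookup≤Δ d u)

bit : Bool → ℕ
bit true  = 1
bit false = 0

count : ∀ {n} → (Fin n → Bool) → ℕ
count f = countᵇ id (Vec.tabulate f)

count-suc : ∀ {n} (f : Fin (suc n) → Bool) → count f ≡ bit (f zero) + count (f ∘ suc)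
count-suc f with f zero
... | true  = refl
... | false = refl

count-cong : ∀ {n} {f g : Fin n → Bool} → (∀ v → f v ≡ g v) → count f ≡ count g
count-cong f≗g = cong (countᵇ id) (Vec.tabulate-cong f≗g)

count-update : ∀ {n} (f g : Fin n → Bool) k → (∀ v → v ≢ k → f v ≡ g v) →
  count f + bit (g k) ≡ count g + bit (f k)
count-update {suc n} f g zero agree = begin
  count f + bit (g zero)                          ≡⟨ cong (_+ bit (g zero)) (count-suc f) ⟩
  bit (f zero) + count (f ∘ suc) + bit (g zero)   ≡⟨ cong (λ c → bit (f zero) + c + bit (g zero)) tails ⟩
  bit (f zero) + count (g ∘ suc) + bit (g zero)   ≡⟨ solve 3 (λ a c b → a :+ c :+ b := b :+ c :+ a) refl (bit (f zero)) _ _ ⟩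
  bit (g zero) + count (g ∘ suc) + bit (f zero)   ≡⟨ cong (_+ bit (f zero)) (count-suc g) ⟨
  count g + bit (f zero)                          ∎
  where
  open ≡-Reasoning
  open +-*-Solver
  tails : count (f ∘ suc) ≡ count (g ∘ suc)
  tails = count-cong (λ v → agree (suc v) λ ())
count-update {suc n} f g (suc k) agree = begin
  count f + bit (g (suc k))                                ≡⟨ cong (_+ bit (g (suc k))) (count-suc f) ⟩
  bit (f zero) + count (f ∘ suc) + bit (g (suc k))         ≡⟨ +-assoc (bit (f zero)) _ _ ⟩
  bit (f zero) + (count (f ∘ suc) + bit (g (suc k)))       ≡⟨ cong₂ _+_ (cong bit (agree zero λ ())) tails ⟩
  bit (g zero) + (count (g ∘ suc) + bit (f (suc k)))       ≡⟨ +-assoc (bit (g zero)) _ _ ⟨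
  bit (g zero) + count (g ∘ suc) + bit (f (suc k))         ≡⟨ cong (_+ bit (f (suc k))) (count-suc g) ⟨
  count g + bit (f (suc k))                                ∎
  where
  open ≡-Reasoning
  tails : count (f ∘ suc) + bit (g (suc k)) ≡ count (g ∘ suc) + bit (f (suc k))
  tails = count-update (f ∘ suc) (g ∘ suc) k (λ v v≢k → agree (suc v) (v≢k ∘ suc-injective))

deg≡count : ∀ {n} (A : Adj n) u → deg A u ≡ count (adj A u)
deg≡count A u = cong (countᵇ id) (sym (Vec.tabulate∘lookup (lookup A u)))

SameEdge : ∀ {n} → Fin n → Fin n → Fin n → Fin n → Set
SameEdge i j u v = (u ≡ i × v ≡ j) ⊎ (u ≡ j × v ≡ i)

sameEdge? : ∀ {n} (i j u v : Fin n) → Dec (SameEdge i j u v)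
sameEdge? i j u v = ((u ≟ i) ×-dec (v ≟ j)) ⊎-dec ((u ≟ j) ×-dec (v ≟ i))

sameEdge-swap : ∀ {n} {i j u v : Fin n} → SameEdge i j u v → SameEdge i j v u
sameEdge-swap (inj₁ (u≡i , v≡j)) = inj₂ (v≡j , u≡i)
sameEdge-swap (inj₂ (u≡j , v≡i)) = inj₁ (v≡i , u≡j)

sameEdge-trans : ∀ {n} {i j i′ j′ u v : Fin n} → SameEdge i j u v → SameEdge i′ j′ u v → SameEdge i j i′ j′
sameEdge-trans (inj₁ (refl , refl)) (inj₁ (refl , refl)) = inj₁ (refl , refl)
sameEdge-trans (inj₁ (refl , refl)) (inj₂ (refl , refl)) = inj₂ (refl , refl)
sameEdge-trans (inj₂ (refl , refl)) (inj₁ (refl , refl)) = inj₂ (refl , refl)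
sameEdge-trans (inj₂ (refl , refl)) (inj₂ (refl , refl)) = inj₁ (refl , refl)

sameEdge-endpoint : ∀ {n} {i j u v k : Fin n} → i ≢ j → SameEdge i j u v → SameEdge i j u k → v ≡ k
sameEdge-endpoint i≢j (inj₁ (_ , refl))    (inj₁ (_ , refl))    = refl
sameEdge-endpoint i≢j (inj₁ (refl , _))    (inj₂ (u≡j , _))    = ⊥-elim (i≢j u≡j)
sameEdge-endpoint i≢j (inj₂ (refl , _))    (inj₁ (u≡i , _))    = ⊥-elim (i≢j (sym u≡i))
sameEdge-endpoint i≢j (inj₂ (_ , refl))    (inj₂ (_ , refl))    = refl

¬sameEdge₁ : ∀ {n} {i j u v : Fin n} → u ≢ i → u ≢ j → ¬ SameEdge i j u v
¬sameEdge₁ u≢i u≢j (inj₁ (u≡i , _)) = u≢i u≡i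
¬sameEdge₁ u≢i u≢j (inj₂ (u≡j , _)) = u≢j u≡j

¬sameEdge₂ : ∀ {n} {i j u v : Fin n} → v ≢ i → v ≢ j → ¬ SameEdge i j u v
¬sameEdge₂ v≢i v≢j (inj₁ (_ , v≡j)) = v≢j v≡j
¬sameEdge₂ v≢i v≢j (inj₂ (_ , v≡i)) = v≢i v≡i

incidence : ∀ {n} → Fin n → Fin n → Fin n → ℕ
incidence u i j = bit (does (u ≟ i)) + bit (does (u ≟ j))

adj-sameEdge : ∀ {n} {A : Adj n} {i j u v} → Symmetric A → SameEdge i j u v → adj A u v ≡ adj A i j
adj-sameEdge sym-A (inj₁ (refl , refl)) = refl
adj-sameEdge sym-A (inj₂ (refl , refl)) = sym-A _ _

setEdge : ∀ {n} → Adj n → Fin n → Fin n → Bool → Adj n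
setEdge A i j b = Vec.tabulate λ u → Vec.tabulate λ v → if does (sameEdge? i j u v) then b else adj A u v

module _ {n} (A : Adj n) {i j : Fin n} {b : Bool} where

  adj-setEdge : ∀ u v → adj (setEdge A i j b) u v ≡ (if does (sameEdge? i j u v) then b else adj A u v)
  adj-setEdge u v = trans (cong (λ row → lookup row v) (Vec.lookup∘tabulate _ u)) (Vec.lookup∘tabulate _ v)

  adj-setEdge-hit : ∀ {u v} → SameEdge i j u v → adj (setEdge A i j b) u v ≡ b
  adj-setEdge-hit {u} {v} s = trans (adj-setEdge u v) (cong (if_then b else adj A u v) (dec-true (sameEdge? i j u v) s))

  adj-setEdge-miss : ∀ {u v} → ¬ SameEdge i j u v → adj (setEdge A i j b) u v ≡ adj A u v
  adj-setEdge-miss {u} {v} s = trans (adj-setEdge u v) (cong (if_then b else adj A u v) (dec-false (sameEdge? i j u v) s))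

  symmetric-setEdge : Symmetric A → Symmetric (setEdge A i j b)
  symmetric-setEdge sym-A u v with sameEdge? i j u v
  ... | yes s = trans (adj-setEdge-hit s) (sym (adj-setEdge-hit (sameEdge-swap s)))
  ... | no ¬s = trans (adj-setEdge-miss ¬s) (trans (sym-A u v) (sym (adj-setEdge-miss (¬s ∘ sameEdge-swap))))

  deg-setEdge-endpoint : i ≢ j → ∀ {u k} → SameEdge i j u k → deg (setEdge A i j b) u + bit (adj A u k) ≡ deg A u + bit b
  deg-setEdge-endpoint i≢j {u} {k} s = begin
    deg (setEdge A i j b) u + bit (adj A u k)          ≡⟨ cong (_+ bit (adj A u k)) (deg≡count (setEdge A i j b) u) ⟩
    count (adj (setEdge A i j b) u) + bit (adj A u k)  ≡⟨ count-update (adj (setEdge A i j b) u) (adj A u) k agree ⟩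
    count (adj A u) + bit (adj (setEdge A i j b) u k)  ≡⟨ cong₂ (λ c e → c + bit e) (sym (deg≡count A u)) (adj-setEdge-hit s) ⟩
    deg A u + bit b                                    ∎
    where
    open ≡-Reasoning
    agree : ∀ v → v ≢ k → adj (setEdge A i j b) u v ≡ adj A u v
    agree v v≢k = adj-setEdge-miss (λ s′ → v≢k (sameEdge-endpoint i≢j s′ s))

  deg-setEdge-other : ∀ {u} → u ≢ i → u ≢ j → deg (setEdge A i j b) u ≡ deg A u
  deg-setEdge-other {u} u≢i u≢j = begin
    deg (setEdge A i j b) u          ≡⟨ deg≡count (setEdge A i j b) u ⟩
    count (adj (setEdge A i j b) u)  ≡⟨ count-cong (λ v → adj-setEdge-miss {u} {v} (¬sameEdge₁ u≢i u≢j)) ⟩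
    count (adj A u)                  ≡⟨ deg≡count A u ⟨
    deg A u                          ∎
    where open ≡-Reasoning

  deg-setEdge : Symmetric A → i ≢ j → adj A i j ≡ not b → ∀ u →
    deg (setEdge A i j b) u + bit (not b) * incidence u i j ≡ deg A u + bit b * incidence u i j
  deg-setEdge sym-A i≢j ij u with u ≟ i | u ≟ j
  ... | yes refl | yes refl = ⊥-elim (i≢j refl)
  ... | yes refl | no _ rewrite *-identityʳ (bit (not b)) | *-identityʳ (bit b) | sym ij =
    deg-setEdge-endpoint i≢j (inj₁ (refl , refl))
  ... | no _ | yes refl rewrite *-identityʳ (bit (not b)) | *-identityʳ (bit b) | sym (trans (sym-A u i) ij) =
    deg-setEdge-endpoint i≢j (inj₂ (refl , refl))
  ... | no u≢i | no u≢j rewrite *-zeroʳ (bit (not b)) | *-zeroʳ (bit b) = cong (_+ 0) (deg-setEdge-other u≢i u≢j)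

-- Switchings: sequences of edge toggles

Toggle : ℕ → Set
Toggle n = Fin n × Fin n × Bool

applyToggles : ∀ {n} → List (Toggle n) → Adj n → Adj n
applyToggles []                 A = A
applyToggles ((i , j , b) ∷ ts) A = applyToggles ts (setEdge A i j b)

undo : ∀ {n} → Toggle n → Toggle n
undo (i , j , b) = i , j , not b

module _ {n : ℕ} where

  Touches : Toggle n → Fin n → Fin n → Set
  Touches (i , j , _) u v = SameEdge i j u v

  DistinctEdges : Toggle n → Toggle n → Set
  DistinctEdges (i , j , _) (i′ , j′ , _) = ¬ SameEdge i j i′ j′

  NonLoop : Toggle n → Set
  NonLoop (i , j , _) = i ≢ j

  Flips : Adj n → Toggle n → Set
  Flips A (i , j , b) = adj A i j ≡ not b

  removedAt addedAt : List (Toggle n) → Fin n → ℕ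
  removedAt []                 u = 0
  removedAt ((i , j , b) ∷ ts) u = bit (not b) * incidence u i j + removedAt ts u
  addedAt   []                 u = 0
  addedAt   ((i , j , b) ∷ ts) u = bit b * incidence u i j + addedAt ts u

  record Switching (A : Adj n) (ts : List (Toggle n)) : Set where
    field
      nonLoops : All NonLoop ts
      distinct : AllPairs DistinctEdges ts
      flips    : All (Flips A) ts
      balanced : ∀ u → removedAt ts u ≡ addedAt ts u

  adj-applyToggles-miss : ∀ ts (A : Adj n) {u v} → All (λ t → ¬ Touches t u v) ts →
    adj (applyToggles ts A) u v ≡ adj A u v
  adj-applyToggles-miss []                 A _          = refl
  adj-applyToggles-miss ((i , j , b) ∷ ts) A (¬t ∷ ¬ts) =
    trans (adj-applyToggles-miss ts (setEdge A i j b) ¬ts) (adj-setEdge-miss A ¬t)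

  adj-applyToggles-hit : ∀ ts (A : Adj n) {i j b u v} → AllPairs DistinctEdges ts → (i , j , b) ∈ ts →
    SameEdge i j u v → adj (applyToggles ts A) u v ≡ b
  adj-applyToggles-hit ((i , j , b) ∷ ts) A (d ∷ _) (here refl) s =
    trans (adj-applyToggles-miss ts (setEdge A i j b) (All.map (λ {t} d-t t-uv → d-t (sameEdge-trans s t-uv)) d))
          (adj-setEdge-hit A s)
  adj-applyToggles-hit ((i , j , b) ∷ ts) A (_ ∷ ds) (there t∈) s = adj-applyToggles-hit ts (setEdge A i j b) ds t∈ s

  adj-applyToggles-decided : ∀ ts (A : Adj n) {u v c} → AllPairs DistinctEdges ts →
    (∀ {i j b} → (i , j , b) ∈ ts → SameEdge i j u v → b ≡ c) →
    (All (λ t → ¬ Touches t u v) ts → adj A u v ≡ c) → adj (applyToggles ts A) u v ≡ c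
  adj-applyToggles-decided ts A {u} {v} ds hit miss with Any.any? (λ { (i , j , _) → sameEdge? i j u v }) ts
  ... | yes t∈ with (i , j , b) , t∈ts , s ← find t∈ = trans (adj-applyToggles-hit ts A ds t∈ts s) (hit t∈ts s)
  ... | no ¬t∈ = trans (adj-applyToggles-miss ts A ¬ts) (miss ¬ts)
    where ¬ts = AllP.¬Any⇒All¬ ts ¬t∈

  adj-applyToggles-kept : ∀ ts (A : Adj n) (R : Fin n → Set) {p q} → AllPairs DistinctEdges ts →
    All (λ { (i , _ , c) → c ≡ true ⊎ R i }) ts → ¬ R p → ¬ R q →
    adj A p q ≡ true → adj (applyToggles ts A) p q ≡ true
  adj-applyToggles-kept ts A R ds only-R-removed ¬Rp ¬Rq pq = adj-applyToggles-decided ts A ds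
    (λ t∈ s → kept (All.lookup only-R-removed t∈) s) (λ _ → pq)
    where
    kept : ∀ {i j c} → c ≡ true ⊎ R i → SameEdge i j _ _ → c ≡ true
    kept (inj₁ c≡true) _                 = c≡true
    kept (inj₂ Ri)     (inj₁ (refl , _)) = ⊥-elim (¬Rp Ri)
    kept (inj₂ Ri)     (inj₂ (_ , refl)) = ⊥-elim (¬Rq Ri)

  symmetric-applyToggles : ∀ ts {A : Adj n} → Symmetric A → Symmetric (applyToggles ts A)
  symmetric-applyToggles []                 sym-A = sym-A
  symmetric-applyToggles ((i , j , b) ∷ ts) {A} sym-A = symmetric-applyToggles ts {setEdge A i j b} (symmetric-setEdge A sym-A)

  deg-applyToggles : ∀ ts {A : Adj n} → Symmetric A → All NonLoop ts → AllPairs DistinctEdges ts → All (Flips A) ts →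
    ∀ u → deg (applyToggles ts A) u + removedAt ts u ≡ deg A u + addedAt ts u
  deg-applyToggles []                 _     _          _        _          u = refl
  deg-applyToggles ((i , j , b) ∷ ts) {A} sym-A (i≢j ∷ nls) (d ∷ ds) (ij ∷ fls) u = begin
    deg A″ u + (r + removedAt ts u)       ≡⟨ solve 3 (λ x r R → x :+ (r :+ R) := (x :+ R) :+ r) refl (deg A″ u) r _ ⟩
    deg A″ u + removedAt ts u + r         ≡⟨ cong (_+ r) (deg-applyToggles ts (symmetric-setEdge A sym-A) nls ds fls′ u) ⟩
    deg A′ u + addedAt ts u + r           ≡⟨ solve 3 (λ x S r → x :+ S :+ r := (x :+ r) :+ S) refl (deg A′ u) _ r ⟩
    deg A′ u + r + addedAt ts u           ≡⟨ cong (_+ addedAt ts u) (deg-setEdge A sym-A i≢j ij u) ⟩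
    deg A u + a + addedAt ts u            ≡⟨ +-assoc (deg A u) a _ ⟩
    deg A u + (a + addedAt ts u)          ∎
    where
    open ≡-Reasoning
    open +-*-Solver using (solve; _:+_; _:=_)
    A′ A″ : Adj n
    A′ = setEdge A i j b
    A″ = applyToggles ts A′
    r a : ℕ
    r = bit (not b) * incidence u i j
    a = bit b * incidence u i j
    fls′ : All (Flips A′) ts
    fls′ = All.zipWith (λ { {i′ , j′ , b′} (d-t , ij′) → trans (adj-setEdge-miss A d-t) ij′ }) (d , fls)

  Adj-ext : {A B : Adj n} → (∀ u v → adj A u v ≡ adj B u v) → A ≡ B
  Adj-ext {A} {B} A≗B = begin
    A                                                   ≡⟨ Vec.tabulate∘lookup A ⟨
    Vec.tabulate (lookup A)                             ≡⟨ Vec.tabulate-cong row≡ ⟩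
    Vec.tabulate (lookup B)                             ≡⟨ Vec.tabulate∘lookup B ⟩
    B                                                   ∎
    where
    open ≡-Reasoning
    row≡ : ∀ u → lookup A u ≡ lookup B u
    row≡ u = trans (sym (Vec.tabulate∘lookup (lookup A u)))
               (trans (Vec.tabulate-cong (A≗B u)) (Vec.tabulate∘lookup (lookup B u)))

  module _ {A : Adj n} {ts : List (Toggle n)} (sw : Switching A ts) where
    open Switching sw

    realization-applyToggles : ∀ {d} → Realization d A → Realization d (applyToggles ts A)
    realization-applyToggles r = record
      { loopless  = λ u → trans (adj-applyToggles-miss ts A (All.map (λ { i≢j (inj₁ (refl , refl)) → i≢j refl
                                                                        ; i≢j (inj₂ (refl , refl)) → i≢j refl }) nonLoops))
                                (loopless r u)
      ; degree    = λ u → trans (+-cancelʳ-≡ _ _ _ (trans (deg-applyToggles ts (symmetric r) nonLoops distinct flips u)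
                                                            (cong (deg A u +_) (sym (balanced u)))))
                                (degree r u)
      ; symmetric = symmetric-applyToggles ts (symmetric r)
      }

    applyToggles-undo : Symmetric A → applyToggles (map undo ts) (applyToggles ts A) ≡ A
    applyToggles-undo sym-A = Adj-ext λ u v → adj-applyToggles-decided (map undo ts) _ distinct′
      (λ t∈ s → undone t∈ s)
      (λ ¬ts → adj-applyToggles-miss ts A (AllP.map⁻ ¬ts))
      where
      distinct′ : AllPairs DistinctEdges (map undo ts)
      distinct′ = AllPairsP.map⁺ (AllPairs.map (λ { {_ , _ , _} {_ , _ , _} d → d }) distinct)
      undone : ∀ {i j b u v} → (i , j , b) ∈ map undo ts → SameEdge i j u v → b ≡ adj A u v
      undone t∈ s with _ , t∈ts , refl ← ∈-map⁻ undo t∈ =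
        sym (trans (adj-sameEdge {A = A} sym-A s) (All.lookup flips t∈ts))

twoSwitch : ∀ {n} → Fin n → Fin n → Fin n → Fin n → List (Toggle n)
twoSwitch w a x y = (w , a , false) ∷ (x , y , false) ∷ (w , x , true) ∷ (a , y , true) ∷ []

-- Take the vertex w out of the path awb (joining a and b) and put it in the middle of the edge xy.
relocate : ∀ {n} → Fin n → Fin n → Fin n → Fin n → Fin n → List (Toggle n)
relocate w a b x y =
  (w , a , false) ∷ (w , b , false) ∷ (x , y , false) ∷ (a , b , true) ∷ (w , x , true) ∷ (w , y , true) ∷ []

record Distinct₅ {n} (w a b x y : Fin n) : Set where
  field
    w≢a : w ≢ a
    w≢b : w ≢ b
    a≢b : a ≢ b
    x≢w : x ≢ w
    x≢a : x ≢ a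
    x≢b : x ≢ b
    y≢w : y ≢ w
    y≢a : y ≢ a
    y≢b : y ≢ b
    x≢y : x ≢ y

balanced-twoSwitch : ∀ {n} (w a x y u : Fin n) → removedAt (twoSwitch w a x y) u ≡ addedAt (twoSwitch w a x y) u
balanced-twoSwitch w a x y u = solve 4 (λ W A X Y →
       con 1 :* (W :+ A) :+ (con 1 :* (X :+ Y) :+ (con 0 :* (W :+ X) :+ (con 0 :* (A :+ Y) :+ con 0)))
    := con 0 :* (W :+ A) :+ (con 0 :* (X :+ Y) :+ (con 1 :* (W :+ X) :+ (con 1 :* (A :+ Y) :+ con 0)))) refl
  (bit (does (u ≟ w))) (bit (does (u ≟ a))) (bit (does (u ≟ x))) (bit (does (u ≟ y)))
  where open +-*-Solver

balanced-relocate : ∀ {n} (w a b x y u : Fin n) → removedAt (relocate w a b x y) u ≡ addedAt (relocate w a b x y) u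
balanced-relocate w a b x y u = solve 5 (λ W A B X Y →
       con 1 :* (W :+ A) :+ (con 1 :* (W :+ B) :+ (con 1 :* (X :+ Y)
         :+ (con 0 :* (A :+ B) :+ (con 0 :* (W :+ X) :+ (con 0 :* (W :+ Y) :+ con 0)))))
    := con 0 :* (W :+ A) :+ (con 0 :* (W :+ B) :+ (con 0 :* (X :+ Y)
         :+ (con 1 :* (A :+ B) :+ (con 1 :* (W :+ X) :+ (con 1 :* (W :+ Y) :+ con 0)))))) refl
  (bit (does (u ≟ w))) (bit (does (u ≟ a))) (bit (does (u ≟ b))) (bit (does (u ≟ x))) (bit (does (u ≟ y)))
  where open +-*-Solver

module _ {n} {G : Adj n} {w a b x y : Fin n} (ds : Distinct₅ w a b x y) where
  open Distinct₅ ds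

  private
    AtWOrX : Fin n → Set
    AtWOrX v = v ≡ w ⊎ v ≡ x

    ¬atWOrX : ∀ {v} → v ≢ w → v ≢ x → ¬ AtWOrX v
    ¬atWOrX v≢w v≢x (inj₁ v≡w) = v≢w v≡w
    ¬atWOrX v≢w v≢x (inj₂ v≡x) = v≢x v≡x

  module TwoSwitch (wa : adj G w a ≡ true) (xy : adj G x y ≡ true) (wx : adj G w x ≡ false) (ay : adj G a y ≡ false) where

    G′ : Adj n
    G′ = applyToggles (twoSwitch w a x y) G

    distinct : AllPairs DistinctEdges (twoSwitch w a x y)
    distinct = (¬sameEdge₁ x≢w x≢a ∷ ¬sameEdge₂ x≢w x≢a ∷ ¬sameEdge₂ y≢w y≢a ∷ [])
             ∷ (¬sameEdge₁ (≢-sym x≢w) (≢-sym y≢w) ∷ ¬sameEdge₁ (≢-sym x≢a) (≢-sym y≢a) ∷ [])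
             ∷ (¬sameEdge₁ (≢-sym w≢a) (≢-sym x≢a) ∷ [])
             ∷ [] ∷ []

    switching : Switching G (twoSwitch w a x y)
    switching = record
      { nonLoops = w≢a ∷ x≢y ∷ ≢-sym x≢w ∷ ≢-sym y≢a ∷ []
      ; distinct = distinct
      ; flips    = wa ∷ xy ∷ wx ∷ ay ∷ []
      ; balanced = balanced-twoSwitch w a x y
      }

    wx′ : adj G′ w x ≡ true
    wx′ = adj-applyToggles-hit (twoSwitch w a x y) G distinct (there (there (here refl))) (inj₁ (refl , refl))

    ay′ : adj G′ a y ≡ true
    ay′ = adj-applyToggles-hit (twoSwitch w a x y) G distinct (there (there (there (here refl)))) (inj₁ (refl , refl))

    wb′ : adj G′ w b ≡ adj G w b
    wb′ = adj-applyToggles-miss (twoSwitch w a x y) G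
      (¬sameEdge₂ (≢-sym w≢b) (≢-sym a≢b) ∷ ¬sameEdge₁ (≢-sym x≢w) (≢-sym y≢w)
      ∷ ¬sameEdge₂ (≢-sym w≢b) (≢-sym x≢b) ∷ ¬sameEdge₁ w≢a (≢-sym y≢w) ∷ [])

    kept : ∀ {p q} → adj G p q ≡ true → p ≢ w → q ≢ w → p ≢ x → q ≢ x → adj G′ p q ≡ true
    kept pq p≢w q≢w p≢x q≢x = adj-applyToggles-kept (twoSwitch w a x y) G AtWOrX distinct
      (inj₂ (inj₁ refl) ∷ inj₂ (inj₂ refl) ∷ inj₁ refl ∷ inj₁ refl ∷ [])
      (¬atWOrX p≢w p≢x) (¬atWOrX q≢w q≢x) pq

  module Relocate (wa : adj G w a ≡ true) (wb : adj G w b ≡ true) (xy : adj G x y ≡ true)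
                  (ab : adj G a b ≡ false) (wx : adj G w x ≡ false) (wy : adj G w y ≡ false) where

    G′ : Adj n
    G′ = applyToggles (relocate w a b x y) G

    distinct : AllPairs DistinctEdges (relocate w a b x y)
    distinct = ( ¬sameEdge₂ (≢-sym w≢b) (≢-sym a≢b) ∷ ¬sameEdge₁ x≢w x≢a ∷ ¬sameEdge₂ (≢-sym w≢b) (≢-sym a≢b)
               ∷ ¬sameEdge₂ x≢w x≢a ∷ ¬sameEdge₂ y≢w y≢a ∷ [])
             ∷ (¬sameEdge₁ x≢w x≢b ∷ ¬sameEdge₁ (≢-sym w≢a) a≢b ∷ ¬sameEdge₂ x≢w x≢b ∷ ¬sameEdge₂ y≢w y≢b ∷ [])
             ∷ ( ¬sameEdge₁ (≢-sym x≢a) (≢-sym y≢a) ∷ ¬sameEdge₁ (≢-sym x≢w) (≢-sym y≢w)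
               ∷ ¬sameEdge₁ (≢-sym x≢w) (≢-sym y≢w) ∷ [])
             ∷ (¬sameEdge₁ w≢a w≢b ∷ ¬sameEdge₁ w≢a w≢b ∷ [])
             ∷ (¬sameEdge₂ y≢w (≢-sym x≢y) ∷ [])
             ∷ [] ∷ []

    switching : Switching G (relocate w a b x y)
    switching = record
      { nonLoops = w≢a ∷ w≢b ∷ x≢y ∷ a≢b ∷ ≢-sym x≢w ∷ ≢-sym y≢w ∷ []
      ; distinct = distinct
      ; flips    = wa ∷ wb ∷ xy ∷ ab ∷ wx ∷ wy ∷ []
      ; balanced = balanced-relocate w a b x y
      }

    ab′ : adj G′ a b ≡ true
    ab′ = adj-applyToggles-hit (relocate w a b x y) G distinct (there (there (there (here refl)))) (inj₁ (refl , refl))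

    wx′ : adj G′ w x ≡ true
    wx′ = adj-applyToggles-hit (relocate w a b x y) G distinct (there (there (there (there (here refl))))) (inj₁ (refl , refl))

    wy′ : adj G′ w y ≡ true
    wy′ = adj-applyToggles-hit (relocate w a b x y) G distinct (there (there (there (there (there (here refl)))))) (inj₁ (refl , refl))

    kept : ∀ {p q} → adj G p q ≡ true → p ≢ w → q ≢ w → p ≢ x → q ≢ x → adj G′ p q ≡ true
    kept pq p≢w q≢w p≢x q≢x = adj-applyToggles-kept (relocate w a b x y) G AtWOrX distinct
      (inj₂ (inj₁ refl) ∷ inj₂ (inj₁ refl) ∷ inj₂ (inj₂ refl) ∷ inj₁ refl ∷ inj₁ refl ∷ inj₁ refl ∷ [])
      (¬atWOrX p≢w p≢x) (¬atWOrX q≢w q≢x) pq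

module _ {n} (A : Adj n) where

  walk-++ : ∀ xs {p zs} → Walk A (xs ++ p ∷ []) → Walk A (p ∷ zs) → Walk A (xs ++ p ∷ zs)
  walk-++ []           _        w₂ = w₂
  walk-++ (x ∷ [])     (e , _)  w₂ = e , w₂
  walk-++ (x ∷ y ∷ ys) (e , w₁) w₂ = e , walk-++ (y ∷ ys) w₁ w₂

  walk-prefix : ∀ xs {ys} → Walk A (xs ++ ys) → Walk A xs
  walk-prefix []           _       = tt
  walk-prefix (x ∷ [])     _       = tt
  walk-prefix (x ∷ y ∷ xs) (e , w) = e , walk-prefix (y ∷ xs) w

  walk-last : ∀ x ys {q} → Walk A (x ∷ ys ++ q ∷ []) → T (adj A (lastOr x ys) q)
  walk-last x []       (e , _) = e
  walk-last x (y ∷ ys) (_ , w) = walk-last y ys w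

  walk-snoc : ∀ x ys {q} → Walk A (x ∷ ys) → T (adj A (lastOr x ys) q) → Walk A (x ∷ ys ++ q ∷ [])
  walk-snoc x []       _       e = e , tt
  walk-snoc x (y ∷ ys) (e , w) e′ = e , walk-snoc y ys w e′

  ClosedWalk : List (Fin n) → Set
  ClosedWalk []       = ⊤
  ClosedWalk (x ∷ xs) = Walk A (x ∷ xs ++ x ∷ [])

  closedWalk-rotate : ∀ i xs → ClosedWalk xs → ClosedWalk (rotate i xs)
  closedWalk-rotate zero    xs           c       = c
  closedWalk-rotate (suc i) []           c       = closedWalk-rotate i [] c
  closedWalk-rotate (suc i) (x ∷ [])     c       = closedWalk-rotate i (x ∷ []) c
  closedWalk-rotate (suc i) (x ∷ y ∷ ys) (e , w) = closedWalk-rotate i (y ∷ ys ++ x ∷ [])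
    (subst (Walk A) (sym (List.++-assoc (y ∷ ys) (x ∷ []) (y ∷ []))) (walk-++ (y ∷ ys) w (e , tt)))

walk-map : ∀ {n} {A B : Adj n} (P : Fin n → Set) zs → Walk A zs → All P zs →
  (∀ {p q} → adj A p q ≡ true → P p → P q → adj B p q ≡ true) → Walk B zs
walk-map P []           _       _                _     = tt
walk-map P (x ∷ [])     _       _                _     = tt
walk-map P (x ∷ y ∷ zs) (e , w) (px ∷ py ∷ pzs) A⇒B =
  Equivalence.from T-≡ (A⇒B (Equivalence.to T-≡ e) px py) , walk-map P (y ∷ zs) w (py ∷ pzs) A⇒B

-- The first vertex of the walk has its successor and its predecessor as distinct neighbours.
2≤degree-closedWalk : ∀ {n} {d : Vec ℕ n} {G : Adj n} v → Realization d G → ∀ R → ClosedWalk G R → Unique R →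
  3 ≤ length R → 2 ≤ lookup d (headOr v R)
2≤degree-closedWalk v r []           _ _ ()
2≤degree-closedWalk v r (_ ∷ [])     _ _ (s≤s ())
2≤degree-closedWalk v r (_ ∷ _ ∷ []) _ _ (s≤s (s≤s ()))
2≤degree-closedWalk {G = G} v r (w ∷ b ∷ m₁ ∷ m) cw (w∉ ∷ b∉ ∷ _) _ =
  subst (2 ≤_) (length-neighbours r w)
    (unique-⊆⇒length-≤ {xs = b ∷ lastOr m₁ m ∷ []} ((b≢a ∷ []) ∷ [] ∷ []) ⊆neighbours)
  where
  b≢a : b ≢ lastOr m₁ m
  b≢a = All.lookup b∉ (lastOr-∈ m₁ m)
  ⊆neighbours : ∀ {z} → z ∈ b ∷ lastOr m₁ m ∷ [] → z ∈ neighbours G w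
  ⊆neighbours (here refl)         = ∈-neighbours⁺ G (Equivalence.to T-≡ (proj₁ cw))
  ⊆neighbours (there (here refl)) =
    ∈-neighbours⁺ G (trans (symmetric r w _) (Equivalence.to T-≡ (walk-last G w (b ∷ m₁ ∷ m) cw)))

Marked : ℕ → Set
Marked n = Adj n × Fin n × List (Fin n)

cycleLists : ∀ n → List (List (Fin n))
cycleLists n = concatMap (allLists (allFin n)) (upTo (suc n))

allMarked : ∀ n → List (Marked n)
allMarked n = cartesianProduct (allAdj n) (cartesianProduct (allFin n) (cycleLists n))

unique-allMarked : ∀ n → Unique (allMarked n)
unique-allMarked n = UniqueP.cartesianProduct⁺ (unique-allAdj n) (UniqueP.cartesianProduct⁺ (UniqueP.allFin⁺ n)
  (unique-concatMap (allLists (allFin n)) length (UniqueP.upTo⁺ (suc n)) (λ m → unique-allLists m (UniqueP.allFin⁺ n))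
    (length-∈-allLists (allFin n) _)))

∈-allMarked : ∀ {n} (G : Adj n) v rest → Unique rest → (G , v , rest) ∈ allMarked n
∈-allMarked {n} G v rest rest! = ∈-cartesianProduct⁺ (∈-allAdj G) (∈-cartesianProduct⁺ (∈-allFin v)
  (∈-concatMap⁺′ (allLists (allFin n)) (∈-upTo⁺ (s≤s length≤n))
    (∈-allLists (allFin n) rest (All.tabulate λ {z} _ → ∈-allFin z))))
  where
  length≤n : length rest ≤ n
  length≤n = subst (length rest ≤_) (List.length-tabulate id) (unique-⊆⇒length-≤ rest! λ {z} _ → ∈-allFin z)

edges : ∀ {n} → Adj n → List (Fin n × Fin n)
edges {n} G = concatMap (λ x → map (x ,_) (neighbours G x)) (allFin n)

module _ {n} {G : Adj n} where

  ∈-edges⁻ : ∀ {x y} → (x , y) ∈ edges G → adj G x y ≡ true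
  ∈-edges⁻ e∈ with x , _ , e∈′ ← ∈-concatMap⁻′ (λ x → map (x ,_) (neighbours G x)) (allFin n) e∈
              with _ , y∈ , refl ← ∈-map⁻ (x ,_) e∈′ = ∈-neighbours⁻ G y∈

  unique-edges : Unique (edges G)
  unique-edges = unique-concatMap _ proj₁ (UniqueP.allFin⁺ n)
    (λ x → UniqueP.map⁺ ,-injectiveʳ (unique-neighbours G x)) proj₁-∈-map

  length-edges : ∀ {d : Vec ℕ n} → Realization d G → length (edges G) ≡ M₁ d
  length-edges {d} r = begin
    length (edges G)                                                   ≡⟨ length-concatMap _ (allFin n) ⟩
    sum (map (λ x → length (map (x ,_) (neighbours G x))) (allFin n))  ≡⟨ cong sum (List.map-cong degree≡ (allFin n)) ⟩
    sum (map (lookup d) (allFin n))                                    ≡⟨ sum-lookup≡M₁ d ⟩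
    M₁ d                                                               ∎
    where
    open ≡-Reasoning
    degree≡ : ∀ x → length (map (x ,_) (neighbours G x)) ≡ lookup d x
    degree≡ x = trans (List.length-map (x ,_) (neighbours G x)) (length-neighbours r x)

walk? : ∀ {n} (A : Adj n) zs → Dec (Walk A zs)
walk? A []           = yes tt
walk? A (x ∷ [])     = yes tt
walk? A (x ∷ y ∷ zs) = T? (adj A x y) ×-dec walk? A (y ∷ zs)

_∈ᵇ_ : ∀ {n} → Fin n → List (Fin n) → Bool
x ∈ᵇ xs = isYes (Any.any? (x ≟_) xs)

-- The edge xy cannot be used to switch away the degree-2 vertex w (with neighbours a and b on the cycle cyc)
-- if x lies on the cycle or if the switching could create a loop or a double edge.
blocked : ∀ {n} → Adj n → List (Fin n) → Fin n → Fin n → Fin n → Fin n × Fin n → Bool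
blocked G cyc w a b (x , y) = x ∈ᵇ cyc ∨ adj G w x ∨ y ∈ᵇ (w ∷ a ∷ b ∷ []) ∨ adj G a y ∨ adj G w y

record Admissible {n} (G : Adj n) (cyc : List (Fin n)) (w a b x y : Fin n) : Set where
  field
    x∉cyc : x ∉ cyc
    ¬wx   : adj G w x ≡ false
    y∉wab : y ∉ w ∷ a ∷ b ∷ []
    ¬ay   : adj G a y ≡ false
    ¬wy   : adj G w y ≡ false

T-not-∨ : ∀ p q → T (not (p ∨ q)) → T (not p) × T (not q)
T-not-∨ false q ¬q = tt , ¬q

admissible : ∀ {n} {G : Adj n} {cyc w a b x y} → T (not (blocked G cyc w a b (x , y))) → Admissible G cyc w a b x y
admissible {G = G} {cyc} {w} {a} {b} {x} {y} ¬blocked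
  with ¬x∈cyc , ¬rest₁ ← T-not-∨ (x ∈ᵇ cyc) _ ¬blocked
  with ¬wx    , ¬rest₂ ← T-not-∨ (adj G w x) _ ¬rest₁
  with ¬y∈wab , ¬rest₃ ← T-not-∨ (y ∈ᵇ (w ∷ a ∷ b ∷ [])) _ ¬rest₂
  with ¬ay    , ¬wy    ← T-not-∨ (adj G a y) _ ¬rest₃ = record
  { x∉cyc = toWitnessFalse {a? = Any.any? (x ≟_) cyc} ¬x∈cyc
  ; ¬wx   = Equivalence.to T-not-≡ ¬wx
  ; y∉wab = toWitnessFalse {a? = Any.any? (y ≟_) (w ∷ a ∷ b ∷ [])} ¬y∈wab
  ; ¬ay   = Equivalence.to T-not-≡ ¬ay
  ; ¬wy   = Equivalence.to T-not-≡ ¬wy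
  }

distinct₅ : ∀ {n} {G : Adj n} {w b m₁ m x y} → (∀ u → adj G u u ≡ false) → Unique (w ∷ b ∷ m₁ ∷ m) →
  Admissible G (w ∷ b ∷ m₁ ∷ m) w (lastOr m₁ m) b x y → adj G x y ≡ true → Distinct₅ w (lastOr m₁ m) b x y
distinct₅ {G = G} {w} {b} {m₁} {m} {x} {y} loopless′ (w∉ ∷ b∉ ∷ _) adm xy = record
  { w≢a = All.lookup w∉ (there a∈)
  ; w≢b = All.lookup w∉ (here refl)
  ; a≢b = λ a≡b → All.lookup b∉ a∈ (sym a≡b)
  ; x≢w = x≢ (here refl)
  ; x≢a = x≢ (there (there a∈))
  ; x≢b = x≢ (there (here refl))
  ; y≢w = λ y≡w → y∉wab (here y≡w)
  ; y≢a = λ y≡a → y∉wab (there (here y≡a))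
  ; y≢b = λ y≡b → y∉wab (there (there (here y≡b)))
  ; x≢y = x≢y
  }
  where
  open Admissible adm
  a∈ : lastOr m₁ m ∈ m₁ ∷ m
  a∈ = lastOr-∈ m₁ m
  x≢ : ∀ {z} → z ∈ w ∷ b ∷ m₁ ∷ m → x ≢ z
  x≢ z∈ refl = x∉cyc z∈
  x≢y : x ≢ y
  x≢y refl with () ← trans (sym (loopless′ x)) xy

lower-order≤ : ∀ N D → 1 ≤ N → 1 ≤ D →
  2 * (((N + 2) * D + (2 * D + (3 * D + (D * D + 2 * D)))) + 6 * (N * (2 * D + 4))) ≤ 94 * (N * (D * D))
lower-order≤ (suc a) (suc b) _ _ = subst (lhs ≤_) lhs+slack (m≤m+n lhs slack)
  where
  open +-*-Solver
  lhs slack : ℕ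
  lhs = 2 * (((suc a + 2) * suc b + (2 * suc b + (3 * suc b + (suc b * suc b + 2 * suc b))))
        + 6 * (suc a * (2 * suc b + 4)))
  slack = 20 * a + 140 * b + 162 * (a * b) + 92 * (b * b) + 94 * (a * (b * b))
  lhs+slack : lhs + slack ≡ 94 * (suc a * (suc b * suc b))
  lhs+slack = solve 2 (λ a b →
      con 2 :* (((con 1 :+ a :+ con 2) :* (con 1 :+ b) :+ (con 2 :* (con 1 :+ b) :+ (con 3 :* (con 1 :+ b)
        :+ ((con 1 :+ b) :* (con 1 :+ b) :+ con 2 :* (con 1 :+ b))))) :+ con 6 :* ((con 1 :+ a) :* (con 2 :* (con 1 :+ b) :+ con 4)))
      :+ (con 20 :* a :+ con 140 :* b :+ con 162 :* (a :* b) :+ con 92 :* (b :* b) :+ con 94 :* (a :* (b :* b)))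
      := con 94 :* ((con 1 :+ a) :* ((con 1 :+ b) :* (con 1 :+ b)))) refl a b

^-cancelˡ-≤ : ∀ k .{{_ : NonZero k}} {a b} → a ^ k ≤ b ^ k → a ≤ b
^-cancelˡ-≤ k {a} {b} aᵏ≤bᵏ with a ≤? b
... | yes a≤b = a≤b
... | no  a≰b = ⊥-elim (<⇒≱ (^-monoˡ-< k (≰⇒> a≰b)) aᵏ≤bᵏ)

cube-root-bound : ∀ {C m D n M} → m ≤ n → C ^ 3 * (D ^ 6 * n ^ 2 * m) ≤ 1 * M ^ 3 → C * (m * (D * D)) ≤ M
cube-root-bound {C} {m} {D} {n} {M} m≤n bound = ^-cancelˡ-≤ 3 (begin
  (C * (m * (D * D))) ^ 3             ≡⟨ solve 3 (λ C m D → (C :* (m :* (D :* D))) :^ 3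
                                                    := C :^ 3 :* (D :^ 6 :* (m :* (m :* con 1)) :* m)) refl C m D ⟩
  C ^ 3 * (D ^ 6 * (m * (m * 1)) * m) ≤⟨ *-monoʳ-≤ (C ^ 3) (*-monoˡ-≤ m (*-monoʳ-≤ (D ^ 6)
                                           (*-mono-≤ m≤n (*-monoˡ-≤ 1 m≤n)))) ⟩
  C ^ 3 * (D ^ 6 * n ^ 2 * m)         ≤⟨ bound ⟩
  1 * M ^ 3                           ≡⟨ *-identityˡ (M ^ 3) ⟩
  M ^ 3                               ∎)
  where
  open ≤-Reasoning
  open +-*-Solver using (solve; _:*_; _:^_; _:=_; con)

module ShortCycles {n} (d : Vec ℕ n) where

  BadMarked : Marked n → Set
  BadMarked (G , v , rest) = T (isRealization d G) × IsCycle G v rest × highDegCount d (v ∷ rest) ≤ 2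

  badMarked? : ∀ t → Dec (BadMarked t)
  badMarked? (G , v , rest) = T? (isRealization d G)
    ×-dec ((2 ≤? length rest) ×-dec (UniqueDec.unique? _≟_ (v ∷ rest) ×-dec walk? G (v ∷ rest ++ v ∷ [])))
    ×-dec (highDegCount d (v ∷ rest) ≤? 2)

  bad : List (Marked n)
  bad = filter badMarked? (allMarked n)

  unique-bad : Unique bad
  unique-bad = UniqueP.filter⁺ badMarked? (unique-allMarked n)

  ∈-bad⁺ : ∀ {t} → BadMarked t → t ∈ bad
  ∈-bad⁺ {G , v , rest} b@(_ , (_ , (_ ∷ rest!) , _) , _) = ∈-filter⁺ badMarked? (∈-allMarked G v rest rest!) b

  ∈-bad⁻ : ∀ {t} → t ∈ bad → BadMarked t
  ∈-bad⁻ t∈ = proj₂ (∈-filter⁻ badMarked? {xs = allMarked n} t∈)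

  realizations : List (Adj n)
  realizations = filterᵇ (isRealization d) (allAdj n)

  ∈-realizations⁺ : ∀ {G} → Realization d G → G ∈ realizations
  ∈-realizations⁺ {G} r = ∈-filter⁺ (T? ∘ isRealization d) (∈-allAdj G) (realization⁺ r)

  ∈-realizations⁻ : ∀ {G} → G ∈ realizations → Realization d G
  ∈-realizations⁻ G∈ = realization⁻ (proj₂ (∈-filter⁻ (T? ∘ isRealization d) {xs = allAdj n} G∈))

  -- A switching of a marked graph: a position on the cycle, and an edge of the graph.
  Switch : Set
  Switch = ℕ × (Fin n × Fin n)

  Target : Set
  Target = Marked n ⊎ Adj n

  -- Applied to the cycle rotated so that it starts with the degree-2 vertex w = headOr v R (followed by b
  -- and preceded by a); a triangle is destroyed, a longer cycle loses the vertex w.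
  switchAt : Adj n → Fin n → List (Fin n) → Fin n × Fin n → Target
  switchAt G v R (x , y) =
    let w = headOr v R ; b = headOr v (drop 1 R) ; a = lastOr v R in
    if length R ≡ᵇ 3 then inj₂ (applyToggles (twoSwitch w a x y) G)
    else if adj G a b then inj₁ (applyToggles (twoSwitch w a x y) G , b , drop 2 R)
    else inj₁ (applyToggles (relocate w a b x y) G , b , drop 2 R)

  switch : Marked n → Switch → Target
  switch (G , v , rest) (i , e) = switchAt G v (rotate i (v ∷ rest)) e

  degree2Positions : Marked n → List ℕ
  degree2Positions (G , v , rest) =
    filterᵇ (λ i → lookup d (headOr v (rotate i (v ∷ rest))) ≡ᵇ 2) (upTo (length (v ∷ rest)))

  admissibleAt : Marked n → ℕ → List (Fin n × Fin n)
  admissibleAt (G , v , rest) i = let R = rotate i (v ∷ rest) in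
    filterᵇ (not ∘ blocked G R (headOr v R) (lastOr v R) (headOr v (drop 1 R))) (edges G)

  forward : Marked n → List Switch
  forward s = concatMap (λ i → map (i ,_) (admissibleAt s i)) (degree2Positions s)

  unrotate : Adj n → ℕ → Fin n → List (Fin n) → Marked n
  unrotate G i w ys = let xs = rotate (length (w ∷ ys) ∸ i) (w ∷ ys) in G , headOr w xs , drop 1 xs

  -- In a switched marked graph (G′, v′, rest′) the removed vertex w sat between a = lastOr v′ rest′ and b = v′.
  module _ (G′ : Adj n) (v′ : Fin n) (rest′ : List (Fin n)) where

    undoTwoSwitches undoRelocations : ℕ → Fin n → List (Marked n × Switch)
    undoTwoSwitches i w = let a = lastOr v′ rest′ in concatMap (λ x → map (λ y →
        unrotate (applyToggles (map undo (twoSwitch w a x y)) G′) i w (v′ ∷ rest′) , i , x , y)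
      (neighbours G′ a)) (neighbours G′ w)
    undoRelocations i w = let a = lastOr v′ rest′ in concatMap (λ x → map (λ y →
        unrotate (applyToggles (map undo (relocate w a v′ x y)) G′) i w (v′ ∷ rest′) , i , x , y)
      (neighbours G′ w)) (neighbours G′ w)

    undoSwitchesAt : ℕ → List (Marked n × Switch)
    undoSwitchesAt i = concatMap (λ w → undoTwoSwitches i w ++ undoRelocations i w) (degree2 d)

  backwardMarked : Marked n → List (Marked n × Switch)
  backwardMarked (G′ , v′ , rest′) = concatMap (undoSwitchesAt G′ v′ rest′) (upTo (suc (length (v′ ∷ rest′))))

  -- All ways to mark a triangle on {w, a, b}, with every position i < 3: more than the
  -- possible sources, which is harmless for an upper bound.
  triangleSources : Adj n → Fin n → Fin n → Fin n → Fin n → Fin n → List (Marked n × Switch)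
  triangleSources G w a b x y = concatMap (λ v → concatMap (λ r₁ → concatMap (λ r₂ →
    map (λ i → (G , v , r₁ ∷ r₂ ∷ []) , i , x , y) (upTo 3)) wab) wab) wab
    where wab = w ∷ a ∷ b ∷ []

  backwardTriangle : Adj n → List (Marked n × Switch)
  backwardTriangle G′ = concatMap (λ w → concatMap (λ x → concatMap (λ b → concatMap (λ a → concatMap (λ y →
    triangleSources (applyToggles (map undo (twoSwitch w a x y)) G′) w a b x y)
    (neighbours G′ a)) (neighbours G′ b)) (neighbours G′ w)) (neighbours G′ w)) (degree2 d)

  backward : Target → List (Marked n × Switch)
  backward (inj₁ t) = backwardMarked t
  backward (inj₂ G) = backwardTriangle G

  targets : List Target
  targets = map inj₁ bad ++ map inj₂ realizations

  ∈-triangleSources : ∀ H w a b x y {v r₁ r₂ i} → v ∈ w ∷ a ∷ b ∷ [] → r₁ ∈ w ∷ a ∷ b ∷ [] → r₂ ∈ w ∷ a ∷ b ∷ [] →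
    i < 3 → ((H , v , r₁ ∷ r₂ ∷ []) , i , x , y) ∈ triangleSources H w a b x y
  ∈-triangleSources H w a b x y {v} {r₁} {r₂} v∈ r₁∈ r₂∈ i<3 =
    ∈-concatMap⁺′ (λ v → concatMap (λ r₁ → concatMap (λ r₂ → map (λ i → (H , v , r₁ ∷ r₂ ∷ []) , i , x , y) (upTo 3)) wab) wab) v∈
    (∈-concatMap⁺′ (λ r₁ → concatMap (λ r₂ → map (λ i → (H , v , r₁ ∷ r₂ ∷ []) , i , x , y) (upTo 3)) wab) r₁∈
    (∈-concatMap⁺′ (λ r₂ → map (λ i → (H , v , r₁ ∷ r₂ ∷ []) , i , x , y) (upTo 3)) r₂∈
    (∈-map⁺ (λ i → (H , v , r₁ ∷ r₂ ∷ []) , i , x , y) (∈-upTo⁺ i<3))))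
    where wab = w ∷ a ∷ b ∷ []

  ∈-backwardTriangle : ∀ {G′ w x b a y σ} → w ∈ degree2 d → x ∈ neighbours G′ w → b ∈ neighbours G′ w →
    a ∈ neighbours G′ b → y ∈ neighbours G′ a →
    σ ∈ triangleSources (applyToggles (map undo (twoSwitch w a x y)) G′) w a b x y → σ ∈ backwardTriangle G′
  ∈-backwardTriangle {G′} {w} {x} {b} {a} {y} w∈ x∈ b∈ a∈ y∈ σ∈ =
    ∈-concatMap⁺′ _ w∈ (∈-concatMap⁺′ _ x∈ (∈-concatMap⁺′ _ b∈ (∈-concatMap⁺′ _ a∈
      (∈-concatMap⁺′ (λ y → triangleSources (applyToggles (map undo (twoSwitch w a x y)) G′) w a b x y) y∈ σ∈))))

  module _ {G′ : Adj n} {v′ : Fin n} {rest′ : List (Fin n)} {i : ℕ} {w x y : Fin n}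
           (i< : i < suc (length (v′ ∷ rest′))) (w∈ : w ∈ degree2 d) (x∈ : x ∈ neighbours G′ w) where

    ∈-backwardMarked-twoSwitch : y ∈ neighbours G′ (lastOr v′ rest′) →
      (unrotate (applyToggles (map undo (twoSwitch w (lastOr v′ rest′) x y)) G′) i w (v′ ∷ rest′) , i , x , y)
        ∈ backwardMarked (G′ , v′ , rest′)
    ∈-backwardMarked-twoSwitch y∈ = ∈-concatMap⁺′ (undoSwitchesAt G′ v′ rest′) (∈-upTo⁺ i<)
      (∈-concatMap⁺′ (λ w → undoTwoSwitches G′ v′ rest′ i w ++ undoRelocations G′ v′ rest′ i w) w∈
      (∈-++⁺ˡ (∈-concatMap⁺′ _ x∈ (∈-map⁺ (λ y →
        unrotate (applyToggles (map undo (twoSwitch w (lastOr v′ rest′) x y)) G′) i w (v′ ∷ rest′) , i , x , y) y∈))))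

    ∈-backwardMarked-relocate : y ∈ neighbours G′ w →
      (unrotate (applyToggles (map undo (relocate w (lastOr v′ rest′) v′ x y)) G′) i w (v′ ∷ rest′) , i , x , y)
        ∈ backwardMarked (G′ , v′ , rest′)
    ∈-backwardMarked-relocate y∈ = ∈-concatMap⁺′ (undoSwitchesAt G′ v′ rest′) (∈-upTo⁺ i<)
      (∈-concatMap⁺′ (λ w → undoTwoSwitches G′ v′ rest′ i w ++ undoRelocations G′ v′ rest′ i w) w∈
      (∈-++⁺ʳ (undoTwoSwitches G′ v′ rest′ i w) (∈-concatMap⁺′ _ x∈ (∈-map⁺ (λ y →
        unrotate (applyToggles (map undo (relocate w (lastOr v′ rest′) v′ x y)) G′) i w (v′ ∷ rest′) , i , x , y) y∈))))

  ∈-triangleSources-rotate : ∀ H {w b a x y i v rest} → rotate (3 ∸ i) (w ∷ b ∷ a ∷ []) ≡ v ∷ rest → i < 3 →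
    ((H , v , rest) , i , x , y) ∈ triangleSources H w a b x y
  ∈-triangleSources-rotate H {i = 0} refl i<3 =
    ∈-triangleSources H _ _ _ _ _ (here refl) (there (there (here refl))) (there (here refl)) i<3
  ∈-triangleSources-rotate H {i = 1} refl i<3 =
    ∈-triangleSources H _ _ _ _ _ (there (here refl)) (here refl) (there (there (here refl))) i<3
  ∈-triangleSources-rotate H {i = 2} refl i<3 =
    ∈-triangleSources H _ _ _ _ _ (there (there (here refl))) (there (here refl)) (here refl) i<3
  ∈-triangleSources-rotate H {i = suc (suc (suc _))} _ (s≤s (s≤s (s≤s ())))

  bad-shortened : ∀ {G G′ : Adj n} {w x b m} → Realization d G′ → 2 ≤ length m →
    ClosedWalk G (w ∷ b ∷ m) → Unique (w ∷ b ∷ m) → highDegCount d (w ∷ b ∷ m) ≤ 2 → x ∉ w ∷ b ∷ m →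
    (∀ {p q} → adj G p q ≡ true → p ≢ w → q ≢ w → p ≢ x → q ≢ x → adj G′ p q ≡ true) →
    adj G′ (lastOr b m) b ≡ true → BadMarked (G′ , b , m)
  bad-shortened {G} {G′} {w} {x} {b} {m} r′ 2≤m (_ , path) (w∉ ∷ bm!) light x∉ kept ab′ =
    realization⁺ r′ , (2≤m , bm! , walk-snoc G′ b m path′ (Equivalence.from T-≡ ab′)) ,
    ≤-trans (length-filterᵇ-∷ (λ u → 3 ≤ᵇ lookup d u) w (b ∷ m)) light
    where
    Avoids : Fin n → Set
    Avoids p = p ≢ w × p ≢ x
    avoids : All Avoids (b ∷ m)
    avoids = All.tabulate λ p∈ → (λ p≡w → All.lookup w∉ p∈ (sym p≡w)) , (λ { refl → x∉ (there p∈) })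
    path′ : Walk G′ (b ∷ m)
    path′ = walk-map Avoids (b ∷ m) (walk-prefix G (b ∷ m) path) avoids
      (λ pq (p≢w , p≢x) (q≢w , q≢x) → kept pq p≢w q≢w p≢x q≢x)

  module _ {G : Adj n} {v : Fin n} {rest : List (Fin n)} (r : Realization d G) where

    Recovered : Target → Switch → Set
    Recovered t σ = t ∈ targets × ((G , v , rest) , σ) ∈ backward t

    unrotate-back : ∀ {H} i w ys → H ≡ G → rotate (length (w ∷ ys) ∸ i) (w ∷ ys) ≡ v ∷ rest →
      unrotate H i w ys ≡ (G , v , rest)
    unrotate-back i w ys refl back = cong (λ xs → G , headOr w xs , drop 1 xs) back

    closedWalk-first : ∀ {w b m} → ClosedWalk G (w ∷ b ∷ m) → adj G w b ≡ true
    closedWalk-first (wb , _) = Equivalence.to T-≡ wb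

    closedWalk-last : ∀ {w b m₁ m} → ClosedWalk G (w ∷ b ∷ m₁ ∷ m) → adj G w (lastOr m₁ m) ≡ true
    closedWalk-last {w} {b} {m₁} {m} cw = trans (symmetric r w _) (Equivalence.to T-≡ (walk-last G w (b ∷ m₁ ∷ m) cw))

    recovered-triangle : ∀ {w b a i x y} → rotate (3 ∸ i) (w ∷ b ∷ a ∷ []) ≡ v ∷ rest → i < 3 →
      ClosedWalk G (w ∷ b ∷ a ∷ []) → lookup d w ≡ 2 → Distinct₅ w a b x y → adj G w a ≡ true → adj G w b ≡ true →
      adj G x y ≡ true → Admissible G (w ∷ b ∷ a ∷ []) w a b x y →
      Recovered (inj₂ (applyToggles (twoSwitch w a x y) G)) (i , x , y)
    recovered-triangle {w} {b} {a} {i} {x} {y} back i<3 (_ , ba , _) w2 ds wa wb xy adm =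
      ∈-++⁺ʳ (map inj₁ bad) (∈-map⁺ inj₂ (∈-realizations⁺ (realization-applyToggles TS.switching r))) ,
      ∈-backwardTriangle {G′} {w} {x} {b} {a} {y} (∈-degree2⁺ d w2)
        (∈-neighbours⁺ G′ TS.wx′) (∈-neighbours⁺ G′ (trans TS.wb′ wb))
        (∈-neighbours⁺ G′ (TS.kept (Equivalence.to T-≡ ba) (≢-sym w≢b) (≢-sym w≢a) (≢-sym x≢b) (≢-sym x≢a)))
        (∈-neighbours⁺ G′ TS.ay′)
        (subst (λ H → ((H , v , rest) , i , x , y) ∈ triangleSources H′ w a b x y)
          (applyToggles-undo TS.switching (symmetric r))
          (∈-triangleSources-rotate _ back i<3))
      where
      open Admissible adm
      open Distinct₅ ds
      module TS = TwoSwitch {G = G} ds wa xy ¬wx ¬ay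
      G′ H′ : Adj n
      G′ = TS.G′
      H′ = applyToggles (map undo (twoSwitch w a x y)) G′

    recovered-long : ∀ {w b m₁ z zs i x y} → let R = w ∷ b ∷ m₁ ∷ z ∷ zs ; a = lastOr z zs in
      rotate (length R ∸ i) R ≡ v ∷ rest → i < length R → ClosedWalk G R → Unique R → highDegCount d R ≤ 2 →
      lookup d w ≡ 2 → Distinct₅ w a b x y → adj G w a ≡ true → adj G w b ≡ true → adj G x y ≡ true →
      Admissible G R w a b x y → Recovered (switchAt G v R (x , y)) (i , x , y)
    recovered-long {w} {b} {m₁} {z} {zs} {i} {x} {y} back i< cw (w∉ ∷ bm!) light w2 ds wa wb xy adm
      with adj G (lastOr z zs) b in ab
    ... | true =
      ∈-++⁺ˡ (∈-map⁺ inj₁ (∈-bad⁺ (bad-shortened (realization-applyToggles TS.switching r) (s≤s (s≤s z≤n))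
        cw (w∉ ∷ bm!) light x∉cyc TS.kept (TS.kept ab (≢-sym w≢a) (≢-sym w≢b) (≢-sym x≢a) (≢-sym x≢b))))) ,
      subst (λ s → (s , i , x , y) ∈ backwardMarked (TS.G′ , b , m))
        (unrotate-back i w (b ∷ m) (applyToggles-undo TS.switching (symmetric r)) back)
        (∈-backwardMarked-twoSwitch {TS.G′} {b} {m} i< (∈-degree2⁺ d w2)
          (∈-neighbours⁺ TS.G′ TS.wx′) (∈-neighbours⁺ TS.G′ TS.ay′))
      where
      m : List (Fin n)
      m = m₁ ∷ z ∷ zs
      open Admissible adm
      open Distinct₅ ds
      module TS = TwoSwitch {G = G} ds wa xy ¬wx ¬ay
    ... | false =
      ∈-++⁺ˡ (∈-map⁺ inj₁ (∈-bad⁺ (bad-shortened (realization-applyToggles RL.switching r) (s≤s (s≤s z≤n))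
        cw (w∉ ∷ bm!) light x∉cyc RL.kept RL.ab′))) ,
      subst (λ s → (s , i , x , y) ∈ backwardMarked (RL.G′ , b , m))
        (unrotate-back i w (b ∷ m) (applyToggles-undo RL.switching (symmetric r)) back)
        (∈-backwardMarked-relocate {RL.G′} {b} {m} i< (∈-degree2⁺ d w2)
          (∈-neighbours⁺ RL.G′ RL.wx′) (∈-neighbours⁺ RL.G′ RL.wy′))
      where
      m : List (Fin n)
      m = m₁ ∷ z ∷ zs
      open Admissible adm
      module RL = Relocate {G = G} ds wa wb xy ab ¬wx ¬wy

    recovered : ∀ R i {x y} → rotate (length R ∸ i) R ≡ v ∷ rest → i < length R →
      ClosedWalk G R → Unique R → highDegCount d R ≤ 2 → 3 ≤ length R → lookup d (headOr v R) ≡ 2 →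
      adj G x y ≡ true → Admissible G R (headOr v R) (lastOr v R) (headOr v (drop 1 R)) x y →
      Recovered (switchAt G v R (x , y)) (i , x , y)
    recovered []           _ _ _ _ _ _ ()
    recovered (_ ∷ [])     _ _ _ _ _ _ (s≤s ())
    recovered (_ ∷ _ ∷ []) _ _ _ _ _ _ (s≤s (s≤s ()))
    recovered (w ∷ b ∷ a ∷ []) i back i< cw R! light _ w2 xy adm =
      recovered-triangle back i< cw w2 (distinct₅ (loopless r) R! adm xy)
        (closedWalk-last {m₁ = a} {[]} cw) (closedWalk-first {m = a ∷ []} cw) xy adm
    recovered (w ∷ b ∷ m₁ ∷ z ∷ zs) i back i< cw R! light _ w2 xy adm =
      recovered-long back i< cw R! light w2 (distinct₅ (loopless r) R! adm xy)
        (closedWalk-last {m₁ = m₁} {z ∷ zs} cw) (closedWalk-first {m = m₁ ∷ z ∷ zs} cw) xy adm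

  ∈-forward⁻ : ∀ {s i e} → (i , e) ∈ forward s → i ∈ degree2Positions s × e ∈ admissibleAt s i
  ∈-forward⁻ {s} σ∈ with i , i∈ , σ∈′ ← ∈-concatMap⁻′ (λ i → map (i ,_) (admissibleAt s i)) (degree2Positions s) σ∈
                     with _ , e∈ , refl ← ∈-map⁻ (i ,_) σ∈′ = i∈ , e∈

  ∈-degree2Positions⁻ : ∀ {G v rest i} → i ∈ degree2Positions (G , v , rest) →
    i < length (v ∷ rest) × lookup d (headOr v (rotate i (v ∷ rest))) ≡ 2
  ∈-degree2Positions⁻ {G} {v} {rest} i∈
    with i∈upTo , w2 ← ∈-filter⁻ (T? ∘ λ i → lookup d (headOr v (rotate i (v ∷ rest))) ≡ᵇ 2)
                                  {xs = upTo (length (v ∷ rest))} i∈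
    = ∈-upTo⁻ i∈upTo , ≡ᵇ⇒≡ _ _ w2

  ∈-admissibleAt⁻ : ∀ {G v rest i e} → let R = rotate i (v ∷ rest) in e ∈ admissibleAt (G , v , rest) i →
    e ∈ edges G × T (not (blocked G R (headOr v R) (lastOr v R) (headOr v (drop 1 R)) e))
  ∈-admissibleAt⁻ {G} {v} {rest} {i} e∈ = let R = rotate i (v ∷ rest) in
    ∈-filter⁻ (T? ∘ (not ∘ blocked G R (headOr v R) (lastOr v R) (headOr v (drop 1 R)))) {xs = edges G} e∈

  forward-recovered : ∀ {s σ} → s ∈ bad → σ ∈ forward s → switch s σ ∈ targets × (s , σ) ∈ backward (switch s σ)
  forward-recovered {G , v , rest} {i , x , y} s∈ σ∈
    with realizes , (2≤ , cyc! , walk) , light ← ∈-bad⁻ s∈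
    with i∈ , e∈ ← ∈-forward⁻ {G , v , rest} σ∈
    with i< , w2 ← ∈-degree2Positions⁻ {G} {v} {rest} i∈
    with xy∈ , ¬blocked ← ∈-admissibleAt⁻ {G} {v} {rest} {i} e∈ =
    recovered (realization⁻ realizes) (rotate i (v ∷ rest)) i (rotate-back i (v ∷ rest) (<⇒≤ i<))
      (subst (i <_) (sym (length-rotate i (v ∷ rest))) i<)
      (closedWalk-rotate G i (v ∷ rest) walk) (unique-rotate i (v ∷ rest) cyc!)
      (subst (_≤ 2) (sym (length-filterᵇ-rotate (λ u → 3 ≤ᵇ lookup d u) i (v ∷ rest))) light)
      (subst (3 ≤_) (sym (length-rotate i (v ∷ rest))) (s≤s 2≤))
      w2 (∈-edges⁻ {G = G} xy∈) (admissible ¬blocked)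

  switchings : List (Marked n × Switch)
  switchings = concatMap (λ s → map (s ,_) (forward s)) bad

  unique-switchings : Unique switchings
  unique-switchings = unique-concatMap _ proj₁ unique-bad (λ s → UniqueP.map⁺ ,-injectiveʳ (unique-forward s)) proj₁-∈-map
    where
    unique-forward : ∀ s → Unique (forward s)
    unique-forward s@(G , v , rest) = unique-concatMap (λ i → map (i ,_) (admissibleAt s i)) proj₁
      (UniqueP.filter⁺ (T? ∘ λ i → lookup d (headOr v (rotate i (v ∷ rest))) ≡ᵇ 2) (UniqueP.upTo⁺ (length (v ∷ rest))))
      (λ i → UniqueP.map⁺ ,-injectiveʳ (UniqueP.filter⁺ _ (unique-edges {G = G}))) proj₁-∈-map

  length-switchings≤ : length switchings ≤ length (concatMap backward targets)
  length-switchings≤ = unique-⊆⇒length-≤ unique-switchings ⊆backward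
    where
    ⊆backward : ∀ {z} → z ∈ switchings → z ∈ concatMap backward targets
    ⊆backward z∈ with s , s∈ , z∈′ ← ∈-concatMap⁻′ (λ s → map (s ,_) (forward s)) bad z∈
                 with σ , σ∈ , refl ← ∈-map⁻ (s ,_) z∈′
      = ∈-concatMap⁺′ backward (proj₁ (forward-recovered s∈ σ∈)) (proj₂ (forward-recovered s∈ σ∈))

  -- Counting forward switchings from below

  edgesFrom : Adj n → List (Fin n) → List (Fin n × Fin n)
  edgesFrom G S = concatMap (λ s → map (s ,_) (neighbours G s)) S

  blockedBound : ℕ → ℕ
  blockedBound k = k * Δ d + (2 * Δ d + (3 * Δ d + (Δ d * Δ d + 2 * Δ d)))

  module _ {G : Adj n} (r : Realization d G) where

    length-edgesFrom : ∀ S → length (edgesFrom G S) ≤ length S * Δ d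
    length-edgesFrom S = length-concatMap-≤ _ S λ {s} _ →
      subst (_≤ Δ d) (sym (List.length-map (s ,_) (neighbours G s))) (length-neighbours≤Δ r s)

    length-filterᵇ-edges-proj₁ : ∀ (p : Fin n → Bool) S → (∀ {u} → T (p u) → u ∈ S) →
      length (filterᵇ (p ∘ proj₁) (edges G)) ≤ length S * Δ d
    length-filterᵇ-edges-proj₁ p S p⊆S =
      ≤-trans (unique-⊆⇒length-≤ (UniqueP.filter⁺ _ (unique-edges {G = G})) ⊆edgesFrom) (length-edgesFrom S)
      where
      ⊆edgesFrom : ∀ {e} → e ∈ filterᵇ (p ∘ proj₁) (edges G) → e ∈ edgesFrom G S
      ⊆edgesFrom {x , y} e∈ with e∈edges , px ← ∈-filter⁻ (T? ∘ (p ∘ proj₁)) {xs = edges G} e∈ =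
        ∈-concatMap⁺′ (λ s → map (s ,_) (neighbours G s)) (p⊆S px) (∈-map⁺ (x ,_) (∈-neighbours⁺ G (∈-edges⁻ {G = G} e∈edges)))

    length-filterᵇ-edges-proj₂ : ∀ (p : Fin n → Bool) S → (∀ {u} → T (p u) → u ∈ S) →
      length (filterᵇ (p ∘ proj₂) (edges G)) ≤ length S * Δ d
    length-filterᵇ-edges-proj₂ p S p⊆S = subst (_≤ length S * Δ d) (List.length-map swap L)
      (≤-trans (unique-⊆⇒length-≤ (UniqueP.map⁺ swap-injective (UniqueP.filter⁺ _ (unique-edges {G = G}))) ⊆edgesFrom)
               (length-edgesFrom S))
      where
      L : List (Fin n × Fin n)
      L = filterᵇ (p ∘ proj₂) (edges G)
      swap-injective : ∀ {e e′ : Fin n × Fin n} → swap e ≡ swap e′ → e ≡ e′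
      swap-injective refl = refl
      ⊆edgesFrom : ∀ {e} → e ∈ map swap L → e ∈ edgesFrom G S
      ⊆edgesFrom e∈ with (x , y) , e∈L , refl ← ∈-map⁻ swap e∈
                    with e∈edges , py ← ∈-filter⁻ (T? ∘ (p ∘ proj₂)) {xs = edges G} e∈L =
        ∈-concatMap⁺′ (λ s → map (s ,_) (neighbours G s)) (p⊆S py)
          (∈-map⁺ (y ,_) (∈-neighbours⁺ G (trans (symmetric r y x) (∈-edges⁻ {G = G} e∈edges))))

    -- One term per clause of blocked; the degree-2 vertex w has only two neighbours.
    length-blocked : ∀ R w a b → lookup d w ≡ 2 → length (filterᵇ (blocked G R w a b) (edges G)) ≤ blockedBound (length R)
    length-blocked R w a b w2 =
      ≤-trans (length-filterᵇ-∨ (λ e → proj₁ e ∈ᵇ R) _ (edges G)) (+-mono-≤ x∈R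
      (≤-trans (length-filterᵇ-∨ (λ e → adj G w (proj₁ e)) _ (edges G)) (+-mono-≤ wx
      (≤-trans (length-filterᵇ-∨ (λ e → proj₂ e ∈ᵇ (w ∷ a ∷ b ∷ [])) _ (edges G)) (+-mono-≤ y∈wab
      (≤-trans (length-filterᵇ-∨ (λ e → adj G a (proj₂ e)) _ (edges G)) (+-mono-≤ ay wy)))))))
      where
      ∈ᵇ⇒∈ : ∀ {u S} → T (u ∈ᵇ S) → u ∈ S
      ∈ᵇ⇒∈ {u} {S} = toWitness {a? = Any.any? (u ≟_) S}
      adj⇒∈ : ∀ {p u} → T (adj G p u) → u ∈ neighbours G p
      adj⇒∈ pu = ∈-neighbours⁺ G (Equivalence.to T-≡ pu)
      length-neighbours-w : length (neighbours G w) ≡ 2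
      length-neighbours-w = trans (length-neighbours r w) w2
      bound : (Fin n × Fin n → Bool) → ℕ → Set
      bound p k = length (filterᵇ p (edges G)) ≤ k
      x∈R : bound (λ e → proj₁ e ∈ᵇ R) (length R * Δ d)
      x∈R = length-filterᵇ-edges-proj₁ (_∈ᵇ R) R ∈ᵇ⇒∈
      wx : bound (λ e → adj G w (proj₁ e)) (2 * Δ d)
      wx = subst (λ k → bound (λ e → adj G w (proj₁ e)) (k * Δ d)) length-neighbours-w
             (length-filterᵇ-edges-proj₁ (adj G w) (neighbours G w) adj⇒∈)
      y∈wab : bound (λ e → proj₂ e ∈ᵇ (w ∷ a ∷ b ∷ [])) (3 * Δ d)
      y∈wab = length-filterᵇ-edges-proj₂ (_∈ᵇ (w ∷ a ∷ b ∷ [])) (w ∷ a ∷ b ∷ []) ∈ᵇ⇒∈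
      ay : bound (λ e → adj G a (proj₂ e)) (Δ d * Δ d)
      ay = ≤-trans (length-filterᵇ-edges-proj₂ (adj G a) (neighbours G a) adj⇒∈) (*-monoˡ-≤ (Δ d) (length-neighbours≤Δ r a))
      wy : bound (λ e → adj G w (proj₂ e)) (2 * Δ d)
      wy = subst (λ k → bound (λ e → adj G w (proj₂ e)) (k * Δ d)) length-neighbours-w
             (length-filterᵇ-edges-proj₂ (adj G w) (neighbours G w) adj⇒∈)

    M₁≤admissible+blocked : ∀ R w a b → lookup d w ≡ 2 →
      M₁ d ≤ length (filterᵇ (not ∘ blocked G R w a b) (edges G)) + blockedBound (length R)
    M₁≤admissible+blocked R w a b w2 = subst (_≤ length (filterᵇ (not ∘ blocked G R w a b) (edges G)) + blockedBound (length R))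
      (length-edges r)
      (≤-trans (length≤length-filterᵇ-+ (not ∘ blocked G R w a b) (blocked G R w a b) (edges G)
                  (λ {e} _ → decide (blocked G R w a b e)))
               (+-monoʳ-≤ (length (filterᵇ (not ∘ blocked G R w a b) (edges G))) (length-blocked R w a b w2)))
      where
      decide : ∀ c → T (not c) ⊎ T c
      decide false = inj₁ tt
      decide true  = inj₂ tt

  degree2Count : Marked n → ℕ
  degree2Count s = length (degree2Positions s)

  degree2Count≡ : ∀ G v rest → degree2Count (G , v , rest) ≡ length (filterᵇ (λ u → lookup d u ≡ᵇ 2) (v ∷ rest))
  degree2Count≡ G v rest = trans
    (length-filterᵇ-∘ (λ u → lookup d u ≡ᵇ 2) (λ i → headOr v (rotate i (v ∷ rest))) (upTo (length (v ∷ rest))))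
    (cong (length ∘ filterᵇ (λ u → lookup d u ≡ᵇ 2)) (headOr-rotate-upTo v (v ∷ rest)))

  length-forward : ∀ s → length (forward s) ≡ sum (map (length ∘ admissibleAt s) (degree2Positions s))
  length-forward s = trans (length-concatMap (λ i → map (i ,_) (admissibleAt s i)) (degree2Positions s))
    (cong sum (List.map-cong (λ i → List.length-map (i ,_) (admissibleAt s i)) (degree2Positions s)))

  module _ {G v rest} (s∈ : (G , v , rest) ∈ bad) where
    private
      s : Marked n
      s = G , v , rest
      bad-s : BadMarked s
      bad-s = ∈-bad⁻ s∈
      r : Realization d G
      r = realization⁻ (proj₁ bad-s)
      cycle : IsCycle G v rest
      cycle = proj₁ (proj₂ bad-s)

    2≤degree-cycle : ∀ {u} → u ∈ v ∷ rest → 2 ≤ lookup d u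
    2≤degree-cycle {u} u∈ with i , _ , refl ← ∈-map⁻ (λ i → headOr v (rotate i (v ∷ rest))) {xs = upTo (length (v ∷ rest))}
                              (subst (u ∈_) (sym (headOr-rotate-upTo v (v ∷ rest))) u∈) =
      2≤degree-closedWalk v r (rotate i (v ∷ rest)) (closedWalk-rotate G i (v ∷ rest) (proj₂ (proj₂ cycle)))
        (unique-rotate i (v ∷ rest) (proj₁ (proj₂ cycle))) (subst (3 ≤_) (sym (length-rotate i (v ∷ rest))) (s≤s (proj₁ cycle)))

    length-cycle≤ : length (v ∷ rest) ≤ degree2Count s + 2
    length-cycle≤ = ≤-trans (length≤length-filterᵇ-+ (λ u → lookup d u ≡ᵇ 2) (λ u → 3 ≤ᵇ lookup d u) (v ∷ rest) split)
      (+-mono-≤ (≤-reflexive (sym (degree2Count≡ G v rest))) (proj₂ (proj₂ bad-s)))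
      where
      split : ∀ {u} → u ∈ v ∷ rest → T (lookup d u ≡ᵇ 2) ⊎ T (3 ≤ᵇ lookup d u)
      split {u} u∈ with lookup d u | 2≤degree-cycle u∈
      ... | 0                 | ()
      ... | 1                 | s≤s ()
      ... | 2                 | _ = inj₁ tt
      ... | suc (suc (suc k)) | _ = inj₂ (≤⇒≤ᵇ {3} {suc (suc (suc k))} (s≤s (s≤s (s≤s z≤n))))

    degree2Count≤n₂ : degree2Count s ≤ n₂ d
    degree2Count≤n₂ = subst₂ _≤_ (sym (degree2Count≡ G v rest)) (length-degree2 d)
      (unique-⊆⇒length-≤ (UniqueP.filter⁺ (T? ∘ λ u → lookup d u ≡ᵇ 2) (proj₁ (proj₂ cycle)))
        λ u∈ → ∈-degree2⁺ d (≡ᵇ⇒≡ _ _ (proj₂ (∈-filter⁻ (T? ∘ λ u → lookup d u ≡ᵇ 2) {xs = v ∷ rest} u∈))))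

    1≤degree2Count : 1 ≤ degree2Count s
    1≤degree2Count = +-cancelʳ-≤ 2 1 (degree2Count s) (≤-trans (s≤s (proj₁ cycle)) length-cycle≤)

    degree2Count*M₁≤ : degree2Count s * M₁ d ≤ length (forward s) + degree2Count s * blockedBound (n₂ d + 2)
    degree2Count*M₁≤ = subst₂ _≤_ (sum-map-const (M₁ d) (degree2Positions s))
      (cong₂ _+_ (sym (length-forward s)) (sum-map-const (blockedBound (n₂ d + 2)) (degree2Positions s)))
      (sum-map-≤-+ (λ _ → M₁ d) (length ∘ admissibleAt s) (λ _ → blockedBound (n₂ d + 2)) (degree2Positions s) atPosition)
      where
      atPosition : ∀ {i} → i ∈ degree2Positions s → M₁ d ≤ length (admissibleAt s i) + blockedBound (n₂ d + 2)
      atPosition {i} i∈ = let R = rotate i (v ∷ rest) in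
        ≤-trans (M₁≤admissible+blocked r R (headOr v R) (lastOr v R) (headOr v (drop 1 R))
                  (proj₂ (∈-degree2Positions⁻ {G} {v} {rest} i∈)))
          (+-monoʳ-≤ (length (admissibleAt s i)) (+-monoˡ-≤ (2 * Δ d + (3 * Δ d + (Δ d * Δ d + 2 * Δ d)))
            (*-monoˡ-≤ (Δ d) length-R≤)))
        where
        length-R≤ : length (rotate i (v ∷ rest)) ≤ n₂ d + 2
        length-R≤ = ≤-trans (≤-reflexive (length-rotate i (v ∷ rest))) (≤-trans length-cycle≤ (+-monoˡ-≤ 2 degree2Count≤n₂))

  -- Counting backward switchings from above

  undoBound : ℕ
  undoBound = n₂ d * (2 * Δ d + 4)

  triangleBound : ℕ
  triangleBound = n₂ d * (2 * (2 * (Δ d * (Δ d * 81))))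

  module _ {G′ : Adj n} (r′ : Realization d G′) where

    private
      two-neighbours : ∀ {w} → w ∈ degree2 d → length (neighbours G′ w) ≡ 2
      two-neighbours w∈ = trans (length-neighbours r′ _) (∈-degree2⁻ d w∈)

      over-degree2 : ∀ (f : Fin n → List (Marked n × Switch)) {K} → (∀ {w} → w ∈ degree2 d → length (f w) ≤ K) →
        length (concatMap f (degree2 d)) ≤ n₂ d * K
      over-degree2 f ≤K = subst (λ m → length (concatMap f (degree2 d)) ≤ m * _) (length-degree2 d)
        (length-concatMap-≤ f (degree2 d) ≤K)

      over-neighbours : ∀ {A : Set} (f : Fin n → List A) u {K} → (∀ {x} → length (f x) ≤ K) →
        length (concatMap f (neighbours G′ u)) ≤ Δ d * K
      over-neighbours f u {K} ≤K = ≤-trans (length-concatMap-≤ f (neighbours G′ u) λ _ → ≤K) (*-monoˡ-≤ K (length-neighbours≤Δ r′ u))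

      over-neighbours-w : ∀ {A : Set} (f : Fin n → List A) {w} → w ∈ degree2 d → ∀ {K} → (∀ {x} → length (f x) ≤ K) →
        length (concatMap f (neighbours G′ w)) ≤ 2 * K
      over-neighbours-w f {w} w∈ {K} ≤K = subst (λ m → length (concatMap f (neighbours G′ w)) ≤ m * K) (two-neighbours w∈)
        (length-concatMap-≤ f (neighbours G′ w) λ _ → ≤K)

    length-undoSwitchesAt : ∀ v′ rest′ i → length (undoSwitchesAt G′ v′ rest′ i) ≤ undoBound
    length-undoSwitchesAt v′ rest′ i = over-degree2 (λ w → undoTwoSwitches G′ v′ rest′ i w ++ undoRelocations G′ v′ rest′ i w) λ {w} w∈ →
      subst (_≤ 2 * Δ d + 4) (sym (List.length-++ (undoTwoSwitches G′ v′ rest′ i w)))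
        (+-mono-≤ (over-neighbours-w _ w∈ (≤-trans (≤-reflexive (List.length-map _ (neighbours G′ (lastOr v′ rest′)))) (length-neighbours≤Δ r′ _)))
                  (over-neighbours-w _ w∈ (≤-reflexive (trans (List.length-map _ (neighbours G′ w)) (two-neighbours w∈)))))

    length-backwardMarked : ∀ v′ rest′ → length (backwardMarked (G′ , v′ , rest′)) ≤ suc (length (v′ ∷ rest′)) * undoBound
    length-backwardMarked v′ rest′ = subst (λ m → length (backwardMarked (G′ , v′ , rest′)) ≤ m * undoBound)
      (List.length-applyUpTo id (suc (length (v′ ∷ rest′))))
      (length-concatMap-≤ (undoSwitchesAt G′ v′ rest′) (upTo (suc (length (v′ ∷ rest′)))) λ {i} _ → length-undoSwitchesAt v′ rest′ i)

    length-backwardTriangle : length (backwardTriangle G′) ≤ triangleBound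
    length-backwardTriangle = over-degree2 _ λ w∈ → over-neighbours-w _ w∈ λ {x} → over-neighbours-w _ w∈ λ {b} →
      over-neighbours _ b λ {a} → over-neighbours _ a λ {y} → ≤-refl

  total : ℕ
  total = sum (map degree2Count bad)

  length-backwardMarked-bad : ∀ {t} → t ∈ bad → length (backwardMarked t) ≤ degree2Count t * (6 * undoBound)
  length-backwardMarked-bad {G , v , rest} t∈ = begin
    length (backwardMarked (G , v , rest))    ≤⟨ length-backwardMarked {G} (realization⁻ (proj₁ (∈-bad⁻ t∈))) v rest ⟩
    suc (length (v ∷ rest)) * undoBound       ≤⟨ *-monoˡ-≤ undoBound (suc≤*6 (length-cycle≤ t∈) (1≤degree2Count t∈)) ⟩
    degree2Count (G , v , rest) * 6 * undoBound ≡⟨ *-assoc (degree2Count (G , v , rest)) 6 undoBound ⟩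
    degree2Count (G , v , rest) * (6 * undoBound) ∎
    where
    open ≤-Reasoning
    suc≤*6 : ∀ {k p} → k ≤ p + 2 → 1 ≤ p → suc k ≤ p * 6
    suc≤*6 {p = suc p} k≤ _ = ≤-trans (s≤s k≤)
      (s≤s (s≤s (≤-trans (≤-reflexive (+-comm p 2)) (+-mono-≤ (s≤s (s≤s z≤n)) (m≤m*n p 6)))))

  length-backward : length (concatMap backward targets) ≤ total * (6 * undoBound) + length realizations * triangleBound
  length-backward = begin
    length (concatMap backward targets)                                   ≡⟨ cong length (List.concatMap-++ backward (map inj₁ bad) _) ⟩
    length (concatMap backward (map inj₁ bad) ++ concatMap backward (map inj₂ realizations))
                                                                          ≡⟨ List.length-++ (concatMap backward (map inj₁ bad)) ⟩
    length (concatMap backward (map inj₁ bad)) + length (concatMap backward (map inj₂ realizations))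
                                                                          ≡⟨ cong₂ (λ xs ys → length xs + length ys)
                                                                              (List.concatMap-map backward inj₁ bad) (List.concatMap-map backward inj₂ realizations) ⟩
    length (concatMap backwardMarked bad) + length (concatMap backwardTriangle realizations)
                                                                          ≤⟨ +-mono-≤ fromBad fromRealizations ⟩
    total * (6 * undoBound) + length realizations * triangleBound        ∎
    where
    open ≤-Reasoning
    fromBad : length (concatMap backwardMarked bad) ≤ total * (6 * undoBound)
    fromBad = subst₂ _≤_ (sym (length-concatMap backwardMarked bad)) (sum-map-* degree2Count (6 * undoBound) bad)
      (sum-map-mono-≤ (length ∘ backwardMarked) (λ t → degree2Count t * (6 * undoBound)) bad length-backwardMarked-bad)
    fromRealizations : length (concatMap backwardTriangle realizations) ≤ length realizations * triangleBound
    fromRealizations = length-concatMap-≤ backwardTriangle realizations λ G∈ → length-backwardTriangle (∈-realizations⁻ G∈)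

  total*M₁≤ : total * M₁ d ≤ length switchings + total * blockedBound (n₂ d + 2)
  total*M₁≤ = subst₂ _≤_ (sum-map-* degree2Count (M₁ d) bad)
    (cong₂ _+_ (sym length-switchings) (sum-map-* degree2Count (blockedBound (n₂ d + 2)) bad))
    (sum-map-≤-+ (λ s → degree2Count s * M₁ d) (length ∘ forward) (λ s → degree2Count s * blockedBound (n₂ d + 2)) bad
      λ { {G , v , rest} s∈ → degree2Count*M₁≤ s∈ })
    where
    length-switchings : length switchings ≡ sum (map (length ∘ forward) bad)
    length-switchings = trans (length-concatMap (λ s → map (s ,_) (forward s)) bad)
      (cong sum (List.map-cong (λ s → List.length-map (s ,_) (forward s)) bad))

  length-bad≤total : length bad ≤ total
  length-bad≤total = length≤sum-map degree2Count bad λ { {G , v , rest} s∈ → 1≤degree2Count s∈ }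

  -- total * (M₁ ∸ J) ≤ |switchings| ≤ total * 6 undoBound + |realizations| * triangleBound, and the hypothesis
  -- lets total * M₁ absorb the terms total * (J + 6 undoBound).
  length-bad*M₁≤ : 2 * (blockedBound (n₂ d + 2) + 6 * undoBound) ≤ M₁ d →
    length bad * M₁ d ≤ 2 * (length realizations * triangleBound)
  length-bad*M₁≤ 2c≤M₁ = ≤-trans (*-monoˡ-≤ (M₁ d) length-bad≤total) (absorb total*M₁≤total*c+X)
    where
    J X : ℕ
    J = blockedBound (n₂ d + 2)
    X = length realizations * triangleBound
    total*M₁≤total*c+X : total * M₁ d ≤ total * (J + 6 * undoBound) + X
    total*M₁≤total*c+X = begin
      total * M₁ d                                   ≤⟨ total*M₁≤ ⟩
      length switchings + total * J                  ≤⟨ +-monoˡ-≤ (total * J) (≤-trans length-switchings≤ length-backward) ⟩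
      total * (6 * undoBound) + X + total * J        ≡⟨ solve 4 (λ t u x j → t :* u :+ x :+ t :* j := t :* (j :+ u) :+ x)
                                                           refl total (6 * undoBound) X J ⟩
      total * (J + 6 * undoBound) + X                ∎
      where
      open ≤-Reasoning
      open +-*-Solver using (solve; _:+_; _:*_; _:=_)
    absorb : total * M₁ d ≤ total * (J + 6 * undoBound) + X → total * M₁ d ≤ 2 * X
    absorb h = +-cancelˡ-≤ (total * M₁ d) (total * M₁ d) (2 * X) (begin
      total * M₁ d + total * M₁ d                         ≡⟨ cong (total * M₁ d +_) (+-identityʳ (total * M₁ d)) ⟨
      2 * (total * M₁ d)                                  ≤⟨ *-monoʳ-≤ 2 h ⟩
      2 * (total * (J + 6 * undoBound) + X)               ≡⟨ solve 3 (λ t c x → con 2 :* (t :* c :+ x) := t :* (con 2 :* c) :+ con 2 :* x)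
                                                                refl total (J + 6 * undoBound) X ⟩
      total * (2 * (J + 6 * undoBound)) + 2 * X           ≤⟨ +-monoˡ-≤ (2 * X) (*-monoʳ-≤ total 2c≤M₁) ⟩
      total * M₁ d + 2 * X                                ∎)
      where
      open ≤-Reasoning
      open +-*-Solver using (solve; _:+_; _:*_; _:=_; con)

  K : ℕ
  K = n₂ d * (Δ d * Δ d)

  bad⇒degree2 : ∀ {s} → s ∈ bad → 1 ≤ n₂ d × 2 ≤ Δ d
  bad⇒degree2 {G , v , rest} s∈ = 1≤n₂ , 2≤Δ
    where
    1≤n₂ : 1 ≤ n₂ d
    1≤n₂ = ≤-trans (1≤degree2Count {G} {v} {rest} s∈) (degree2Count≤n₂ {G} {v} {rest} s∈)
    2≤Δ : 2 ≤ Δ d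
    2≤Δ with w , w∈ ← ∃-∈ (subst (1 ≤_) (sym (length-degree2 d)) 1≤n₂) =
      subst (_≤ Δ d) (∈-degree2⁻ d w∈) (lookup≤Δ d w)

  fraction-bad : ∀ q → (648 * q + 94) * K ≤ M₁ d → q * length bad ≤ numRealizations d
  fraction-bad q CK≤M₁ with bad in eq
  ... | []    = subst (_≤ numRealizations d) (sym (*-zeroʳ q)) z≤n
  ... | s ∷ _ = subst (λ xs → q * length xs ≤ numRealizations d) eq
                  (*-cancelʳ-≤ (q * length bad) #G (M₁ d) {{>-nonZero 1≤M₁}} (begin
      q * length bad * M₁ d            ≡⟨ *-assoc q (length bad) (M₁ d) ⟩
      q * (length bad * M₁ d)          ≤⟨ *-monoʳ-≤ q (length-bad*M₁≤ (≤-trans (lower-order≤ (n₂ d) (Δ d) 1≤n₂ 1≤Δ) 94K≤M₁)) ⟩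
      q * (2 * (#G * triangleBound))   ≡⟨ solve 4 (λ q g N D → q :* (con 2 :* (g :* (N :* (con 2 :* (con 2 :* (D :* (D :* con 81)))))))
                                                  := g :* (con 648 :* q :* (N :* (D :* D)))) refl q #G (n₂ d) (Δ d) ⟩
      #G * (648 * q * K)               ≤⟨ *-monoʳ-≤ #G 648qK≤M₁ ⟩
      #G * M₁ d                        ∎))
    where
    open ≤-Reasoning
    open +-*-Solver using (solve; _:+_; _:*_; _:=_; con)
    #G : ℕ
    #G = numRealizations d
    1≤n₂ : 1 ≤ n₂ d
    1≤n₂ = proj₁ (bad⇒degree2 (subst (s ∈_) (sym eq) (here refl)))
    1≤Δ : 1 ≤ Δ d
    1≤Δ = <⇒≤ (proj₂ (bad⇒degree2 (subst (s ∈_) (sym eq) (here refl))))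
    94K≤M₁ : 94 * K ≤ M₁ d
    94K≤M₁ = ≤-trans (*-monoˡ-≤ K (m≤n+m 94 (648 * q))) CK≤M₁
    648qK≤M₁ : 648 * q * K ≤ M₁ d
    648qK≤M₁ = ≤-trans (*-monoˡ-≤ K (m≤m+n (648 * q) 94)) CK≤M₁
    1≤M₁ : 1 ≤ M₁ d
    1≤M₁ = ≤-trans (≤-trans (*-mono-≤ 1≤n₂ (*-mono-≤ 1≤Δ 1≤Δ)) (m≤n*m K 94)) 94K≤M₁

  length≤length-bad : ∀ L → Unique L → All (λ A → T (isRealization d A) × HasShortCycle d A) L → length L ≤ length bad
  length≤length-bad L L! shortCycled = subst (length L ≤_) (List.length-map proj₁ bad) (unique-⊆⇒length-≤ L! ⊆graphs)
    where
    ⊆graphs : ∀ {A} → A ∈ L → A ∈ map proj₁ bad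
    ⊆graphs A∈ with realizes , v , rest , cycle , light ← All.lookup shortCycled A∈ =
      ∈-map⁺ proj₁ (∈-bad⁺ (realizes , cycle , light))

open ShortCycles using (fraction-bad; length≤length-bad)

lemma3p5 : (D : (n : ℕ) → Vec ℕ n)
    → (∃ λ N₀ → ∀ n → N₀ ≤ n → V.All (λ x → 1 ≤ x) (D n) × Graphical (D n))
    → (∀ p q → 0 < p → 0 < q → ∃ λ N → ∀ n → N ≤ n →
         q * (Δ (D n) ^ 6 * n ^ 2 * n₂ (D n)) ≤ p * M₁ (D n) ^ 3)
    → (∀ p q → 0 < p → 0 < q → ∃ λ N → ∀ n → N ≤ n →
         (L : List (Adj n)) → Unique L
         → All (λ A → T (isRealization (D n) A) × HasShortCycle (D n) A) L
         → q * length L ≤ p * numRealizations (D n))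
lemma3p5 D _ sparse p q 0<p 0<q = N , λ n N≤n L L! shortCycled → begin
  q * length L                       ≤⟨ *-monoʳ-≤ q (length≤length-bad (D n) L L! shortCycled) ⟩
  q * length (ShortCycles.bad (D n)) ≤⟨ fraction-bad (D n) q (cube-root-bound {C} {D = Δ (D n)} (n₂≤n (D n)) (bound n N≤n)) ⟩
  numRealizations (D n)              ≤⟨ m≤n*m (numRealizations (D n)) p {{>-nonZero 0<p}} ⟩
  p * numRealizations (D n)          ∎
  where
  open ≤-Reasoning
  C : ℕ
  C = 648 * q + 94
  0<C³ : 0 < C ^ 3
  0<C³ = m^n>0 C {{>-nonZero (≤-trans (s≤s z≤n) (m≤n+m 94 (648 * q)))}} 3
  N : ℕ
  N = proj₁ (sparse 1 (C ^ 3) (s≤s z≤n) 0<C³)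
  bound : ∀ n → N ≤ n → C ^ 3 * (Δ (D n) ^ 6 * n ^ 2 * n₂ (D n)) ≤ 1 * M₁ (D n) ^ 3
  bound = proj₂ (sparse 1 (C ^ 3) (s≤s z≤n) 0<C³)
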